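{- Let $n\geq 4$ and let $G$ be a pineapple graph on $n$ vertices, i.e. $G$ is isomorphic to $U_{n,g}^p$ for some $3\leq g<n$. Then $$n^2+1+\binom{n-2}{2}\leq F(G)\leq 7\cdot 2^{n-3}+n,$$ with equality on the right if and only if $G$ is isomorphic to $U_{n,3}^p$, and equality on the left if and only if $G$ is isomorphic to $U_{n,n-1}^p$.
   Context: All graphs are finite, simple and undirected. The pineapple graph $U_{n,g}^p$ ($3\leq g<n$) is obtained from the cycle $C_g$ by attaching $n-g$ new pendant vertices to a single vertex of the cycle. A connected subgraph of a graph $G=(V,E)$ is a graph $(V',E')$ with $\emptyset\neq V'\subseteq V$, $E'\subseteq E$, every edge of $E'$ having both endpoints in $V'$, and $(V',E')$ connected; distinct pairs $(V',E')$ are counted separately. The core index $F(G)$ is the number of connected subgraphs of $G$. -}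

module Defs where

open import Data.Nat using (ℕ; zero; suc; _∸_; _≡ᵇ_; _<ᵇ_; _≤ᵇ_)
open import Data.Fin using (Fin; toℕ)
open import Data.Fin.Permutation using (Permutation′; _⟨$⟩ʳ_)
open import Data.Bool using (Bool; true; false; _∧_; _∨_; not)
open import Data.Bool.Properties using (∨-comm)
open import Data.List using (List; []; _∷_; map; length; concatMap; allFin; filterᵇ)
open import Data.Bool.ListAction using (any; all)
open import Data.Vec using (Vec; lookup) renaming ([] to []ᵥ; _∷_ to _∷ᵥ_)
open import Data.Product using (Σ; _×_; _,_; proj₁; proj₂)
open import Relation.Binary.PropositionalEquality using (_≡_; refl; cong; cong₂)

record Graph (n : ℕ) : Set where
  field
    adj        : Fin n → Fin n → Bool
    adj-sym    : ∀ i j → adj i j ≡ adj j i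
    adj-irrefl : ∀ i → adj i i ≡ false
open Graph public

_≅_ : ∀ {n} → Graph n → Graph n → Set
_≅_ {n} G H = Σ (Permutation′ n) λ σ →
  ∀ i j → adj G i j ≡ adj H (σ ⟨$⟩ʳ i) (σ ⟨$⟩ʳ j)

_==_ : ∀ {n} → Fin n → Fin n → Bool
a == b = toℕ a ≡ᵇ toℕ b

subsets : (n : ℕ) → List (Vec Bool n)
subsets zero    = []ᵥ ∷ []
subsets (suc n) = concatMap (λ v → (false ∷ᵥ v) ∷ (true ∷ᵥ v) ∷ []) (subsets n)

-- all sublists (subsets of positions) of a list, each choice exactly once
sublists : ∀ {A : Set} → List A → List (List A)
sublists []       = [] ∷ []
sublists (x ∷ xs) = concatMap (λ s → s ∷ (x ∷ s) ∷ []) (sublists xs)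

edges : ∀ {n} → Graph n → List (Fin n × Fin n)
edges {n} G = filterᵇ (λ p → (toℕ (proj₁ p) <ᵇ toℕ (proj₂ p)) ∧ adj G (proj₁ p) (proj₂ p))
                      (concatMap (λ i → map (λ j → (i , j)) (allFin n)) (allFin n))

joins : ∀ {n} → List (Fin n × Fin n) → Fin n → Fin n → Bool
joins E u v = any (λ e → ((proj₁ e == u) ∧ (proj₂ e == v)) ∨ ((proj₁ e == v) ∧ (proj₂ e == u))) E

walk≤ : ∀ {n} → ℕ → List (Fin n × Fin n) → Fin n → Fin n → Bool
walk≤ zero    E u v = u == v
walk≤ {n} (suc k) E u v = (u == v) ∨ any (λ w → joins E u w ∧ walk≤ k E w v) (allFin n)

-- (V' , E') is a connected subgraph: V' nonempty, every edge of E' has both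
-- endpoints in V', and any two vertices of V' are joined by a walk in E'
-- (a walk of length ≤ n suffices, as any path has fewer than n edges).
isConnectedSubgraph : ∀ {n} → Vec Bool n → List (Fin n × Fin n) → Bool
isConnectedSubgraph {n} V E =
  any (lookup V) (allFin n)
  ∧ all (λ e → lookup V (proj₁ e) ∧ lookup V (proj₂ e)) E
  ∧ all (λ u → all (λ v → not (lookup V u ∧ lookup V v) ∨ walk≤ n E u v) (allFin n)) (allFin n)

F : ∀ {n} → Graph n → ℕ
F {n} G = length (filterᵇ (λ p → isConnectedSubgraph (proj₁ p) (proj₂ p))
                         (concatMap (λ V → map (λ E → (V , E)) (sublists (edges G))) (subsets n)))

-- The pineapple graph U^p_{n,g} on vertices 0..n-1: the cycle
-- 0 - 1 - ... - (g-1) - 0, and pendant vertices g..n-1 attached to 0.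

pineRaw : ℕ → ℕ → ℕ → Bool
pineRaw g a b = ((suc a ≡ᵇ b) ∧ (b <ᵇ g)) ∨ ((a ≡ᵇ 0) ∧ (b ≡ᵇ g ∸ 1)) ∨ ((a ≡ᵇ 0) ∧ (g ≤ᵇ b))

private
  ≡ᵇ-refl : ∀ a → (a ≡ᵇ a) ≡ true
  ≡ᵇ-refl zero    = refl
  ≡ᵇ-refl (suc a) = ≡ᵇ-refl a

  ≡ᵇ-sym : ∀ a b → (a ≡ᵇ b) ≡ (b ≡ᵇ a)
  ≡ᵇ-sym zero    zero    = refl
  ≡ᵇ-sym zero    (suc b) = refl
  ≡ᵇ-sym (suc a) zero    = refl
  ≡ᵇ-sym (suc a) (suc b) = ≡ᵇ-sym a b

pineAdj : ∀ {n} → ℕ → Fin n → Fin n → Bool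
pineAdj g i j = not (toℕ i ≡ᵇ toℕ j) ∧ (pineRaw g (toℕ i) (toℕ j) ∨ pineRaw g (toℕ j) (toℕ i))

Pineapple : (n g : ℕ) → Graph n
Pineapple n g = record
  { adj        = pineAdj g
  ; adj-sym    = λ i j → cong₂ _∧_ (cong not (≡ᵇ-sym (toℕ i) (toℕ j)))
                                   (∨-comm (pineRaw g (toℕ i) (toℕ j)) (pineRaw g (toℕ j) (toℕ i)))
  ; adj-irrefl = λ i → cong (λ b → not b ∧ (pineRaw g (toℕ i) (toℕ i) ∨ pineRaw g (toℕ i) (toℕ i)))
                            (≡ᵇ-refl (toℕ i))
  }

IsPineapple : ∀ {n} → Graph n → Set
IsPineapple {n} G = Σ ℕ λ g → (3 Data.Nat.≤ g) × (g Data.Nat.< n) × (G ≅ Pineapple n g)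

module Submission where

-- We compute F on every U^p_{n,g} exactly.  The recursion runs on  Fwith G R,
-- the number of connected subgraphs whose vertex set contains R (F = Fwith ∅).
-- Sorting connected subgraphs by how they meet the last vertex ℓ gives
-- recurrences for ℓ pendant, for ℓ of degree two, and for adding one edge
-- (module DeleteLast, add-edge).  Applied to paths, cycles and then pineapples
-- they give  F(U^p_{n,g}) = g² + 1 + k + (2^k − 1)(g(g+1)/2 + 1)  with k = n − g
-- (F-pineapple).  F is invariant under isomorphism (module Relabel), and for
-- fixed n the closed form strictly decreases in g (pineappleF-antitone), which
-- yields both bounds and both equality cases.

open import Defs
open import Data.Nat using (ℕ; zero; suc; _+_; _*_; _∸_; _^_; _≤_; _<_; z≤n; s≤s; _≡ᵇ_; _<ᵇ_; _≤ᵇ_)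
open import Data.Nat.Properties
open import Data.Nat.Combinatorics using (_C_; nCk+nC[k+1]≡[n+1]C[k+1]; nC1≡n)
open import Data.Nat.Tactic.RingSolver using (solve-∀)
open import Data.Nat.ListAction using (sum)
open import Data.Nat.ListAction.Properties using (sum-++; sum-↭)
open import Data.Bool using (Bool; true; false; _∧_; _∨_; not; T; T?; if_then_else_)
open import Data.Bool.Properties using (∨-comm; ∧-comm; ∧-identityʳ; ∧-zeroʳ; ∨-identityʳ; ∨-zeroʳ; ∨-idem)
open import Data.Bool.ListAction using (any; all; and)
open import Data.Unit using (tt)
open import Data.Empty using (⊥; ⊥-elim)
open import Data.Fin using (Fin; toℕ; inject₁; fromℕ) renaming (zero to fz; suc to fs)
open import Data.Fin.Properties using (toℕ-injective; toℕ-inject₁; toℕ-fromℕ; toℕ<n; inject₁-injective; fromℕ≢inject₁)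
open import Data.Fin.Relation.Unary.Top using (view; view-fromℕ; view-inject₁; ‵fromℕ; ‵inject₁)
open import Data.Fin.Permutation using (_⟨$⟩ʳ_; _⟨$⟩ˡ_; inverseˡ; inverseʳ)
open import Data.Vec using (Vec; lookup; tabulate; replicate; _∷ʳ_) renaming ([] to []ᵥ; _∷_ to _∷ᵥ_)
open import Data.Vec.Properties using (∷-injectiveʳ; lookup-replicate; lookup∘tabulate; tabulate∘lookup; tabulate-cong)
open import Data.List using (List; []; _∷_; map; length; concatMap; allFin; cartesianProduct; _++_; null)
open import Data.List.Properties using (length-tabulate; map-tabulate; map-++)
open import Data.List.Membership.Propositional using (_∈_)
open import Data.List.Membership.Propositional.Properties using (∈-allFin; ∈-map⁺; ∈-map⁻; ∈-++⁺ˡ; ∈-++⁺ʳ; ∈-++⁻; ∈-concatMap⁺; ∈-concatMap⁻; ∈-filter⁺; ∈-filter⁻; ∈-cartesianProduct⁺)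
open import Data.List.Membership.Propositional.Properties.WithK using (unique∧set⇒bag)
open import Data.List.Relation.Binary.BagAndSetEquality using (∼bag⇒↭)
open import Data.List.Relation.Binary.Permutation.Propositional using (_↭_)
open import Data.List.Relation.Binary.Permutation.Propositional.Properties using () renaming (map⁺ to ↭-map⁺)
open import Data.List.Relation.Unary.Any as Any using (here; there)
open import Data.List.Relation.Unary.All as All using (All; []; _∷_)
open import Data.List.Relation.Unary.AllPairs using (AllPairs; []; _∷_)
import Data.List.Relation.Unary.AllPairs.Properties as AllPairsₚ
open import Data.List.Relation.Unary.Unique.Propositional using (Unique)
open import Data.List.Relation.Unary.Unique.Propositional.Properties using (map⁺; ++⁺; filter⁺; cartesianProduct⁺; allFin⁺)
open import Data.Product using (∃; _×_; _,_; proj₁; proj₂)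
open import Data.Sum using (_⊎_; inj₁; inj₂)
open import Function using (_∘_; id)
open import Function.Bundles using (_⇔_; mk⇔)
open import Relation.Nullary using (¬_)
open import Relation.Binary using (tri<; tri≈; tri>)
open import Relation.Binary.PropositionalEquality

sumL : ∀ {A : Set} → (A → ℕ) → List A → ℕ
sumL f xs = sum (map f xs)

b2n : Bool → ℕ
b2n true = 1
b2n false = 0

cnt : ∀ {A : Set} → (A → Bool) → List A → ℕ
cnt p = sumL (b2n ∘ p)

length-filterᵇ : ∀ {A : Set} (p : A → Bool) xs → length (Data.List.filterᵇ p xs) ≡ cnt p xs
length-filterᵇ p [] = refl
length-filterᵇ p (x ∷ xs) with p x
... | true = cong suc (length-filterᵇ p xs)
... | false = length-filterᵇ p xs

sumL-++ : ∀ {A : Set} (f : A → ℕ) xs ys → sumL f (xs ++ ys) ≡ sumL f xs + sumL f ys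
sumL-++ f xs ys = trans (cong sum (map-++ f xs ys)) (sum-++ (map f xs) (map f ys))

sumL-map : ∀ {A B : Set} (g : B → ℕ) (f : A → B) xs → sumL g (map f xs) ≡ sumL (g ∘ f) xs
sumL-map g f [] = refl
sumL-map g f (x ∷ xs) = cong (g (f x) +_) (sumL-map g f xs)

sumL-concatMap : ∀ {A B : Set} (f : B → ℕ) (g : A → List B) xs →
  sumL f (concatMap g xs) ≡ sumL (λ x → sumL f (g x)) xs
sumL-concatMap f g [] = refl
sumL-concatMap f g (x ∷ xs) = trans (sumL-++ f (g x) (concatMap g xs)) (cong (sumL f (g x) +_) (sumL-concatMap f g xs))

sumL-cong : ∀ {A : Set} {f g : A → ℕ} xs → (∀ x → x ∈ xs → f x ≡ g x) → sumL f xs ≡ sumL g xs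
sumL-cong [] h = refl
sumL-cong (x ∷ xs) h = cong₂ _+_ (h x (here refl)) (sumL-cong xs (λ y y∈ → h y (there y∈)))

cnt-cong : ∀ {A : Set} {p q : A → Bool} xs → (∀ x → x ∈ xs → p x ≡ q x) → cnt p xs ≡ cnt q xs
cnt-cong xs h = sumL-cong xs (λ x x∈ → cong b2n (h x x∈))

sumL-+ : ∀ {A : Set} (f g : A → ℕ) xs → sumL (λ x → f x + g x) xs ≡ sumL f xs + sumL g xs
sumL-+ f g [] = refl
sumL-+ f g (x ∷ xs) rewrite sumL-+ f g xs = +-+-interchange (f x) (g x) (sumL f xs) (sumL g xs)
  where
  +-+-interchange : ∀ a b c d → a + b + (c + d) ≡ a + c + (b + d)
  +-+-interchange = solve-∀

sumL-0 : ∀ {A : Set} (xs : List A) → sumL (λ _ → 0) xs ≡ 0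
sumL-0 [] = refl
sumL-0 (x ∷ xs) = sumL-0 xs

cnt-false : ∀ {A : Set} (xs : List A) → cnt (λ _ → false) xs ≡ 0
cnt-false = sumL-0

sumL-↭ : ∀ {A : Set} (f : A → ℕ) {xs ys} → xs ↭ ys → sumL f xs ≡ sumL f ys
sumL-↭ f p = sum-↭ (↭-map⁺ f p)

bool-ext : ∀ {a b : Bool} → (a ≡ true → b ≡ true) → (b ≡ true → a ≡ true) → a ≡ b
bool-ext {false} {false} f g = refl
bool-ext {false} {true} f g = g refl
bool-ext {true} {false} f g = sym (f refl)
bool-ext {true} {true} f g = refl

T⇒ : ∀ {b} → T b → b ≡ true
T⇒ {true} _ = refl

⇒T : ∀ {b} → b ≡ true → T b
⇒T refl = tt

∧⇒ : ∀ {a b} → a ∧ b ≡ true → a ≡ true × b ≡ true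
∧⇒ {true} {true} e = refl , refl

⇒∧ : ∀ {a b} → a ≡ true → b ≡ true → a ∧ b ≡ true
⇒∧ refl refl = refl

∨⇒ : ∀ {a b} → a ∨ b ≡ true → a ≡ true ⊎ b ≡ true
∨⇒ {true} e = inj₁ refl
∨⇒ {false} e = inj₂ e

∨ˡ : ∀ {a} b → a ≡ true → a ∨ b ≡ true
∨ˡ b refl = refl

∨ʳ : ∀ a {b} → b ≡ true → a ∨ b ≡ true
∨ʳ true e = refl
∨ʳ false e = e

not⇒ : ∀ {a} → not a ≡ true → a ≡ false
not⇒ {false} e = refl

t≢f : ∀ {a} → a ≡ true → a ≡ false → ⊥
t≢f refl ()

¬t⇒f : ∀ {a} → ¬ (a ≡ true) → a ≡ false
¬t⇒f {false} _ = refl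
¬t⇒f {true} h = ⊥-elim (h refl)

if-t : ∀ {b : Bool} {x y : ℕ} → b ≡ true → (if b then x else y) ≡ x
if-t refl = refl

any⇒ : ∀ {A : Set} (f : A → Bool) xs → any f xs ≡ true → ∃ λ x → x ∈ xs × f x ≡ true
any⇒ f (x ∷ xs) e with ∨⇒ {f x} e
... | inj₁ fx = x , here refl , fx
... | inj₂ r with any⇒ f xs r
... | y , y∈ , fy = y , there y∈ , fy

⇒any : ∀ {A : Set} (f : A → Bool) {xs x} → x ∈ xs → f x ≡ true → any f xs ≡ true
⇒any f {x ∷ xs} (here refl) fx = ∨ˡ _ fx
⇒any f {y ∷ xs} (there x∈) fx = ∨ʳ (f y) (⇒any f x∈ fx)

all⇒ : ∀ {A : Set} (f : A → Bool) {xs x} → all f xs ≡ true → x ∈ xs → f x ≡ true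
all⇒ f {y ∷ xs} e (here refl) = proj₁ (∧⇒ e)
all⇒ f {y ∷ xs} e (there x∈) = all⇒ f (proj₂ (∧⇒ {f y} e)) x∈

⇒all : ∀ {A : Set} (f : A → Bool) xs → (∀ x → x ∈ xs → f x ≡ true) → all f xs ≡ true
⇒all f [] h = refl
⇒all f (x ∷ xs) h = ⇒∧ (h x (here refl)) (⇒all f xs (λ y y∈ → h y (there y∈)))

all-false : ∀ {A : Set} (f : A → Bool) xs → all f xs ≡ false → ∃ λ x → x ∈ xs × f x ≡ false
all-false f (x ∷ xs) e with f x in eq
... | false = x , here refl , eq
... | true with all-false f xs e
... | y , y∈ , fy = y , there y∈ , fy

all-true : ∀ {A : Set} (xs : List A) → all (λ _ → true) xs ≡ true
all-true [] = refl
all-true (x ∷ xs) = all-true xs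

any-cong : ∀ {A : Set} {f g : A → Bool} xs → (∀ x → f x ≡ g x) → any f xs ≡ any g xs
any-cong [] h = refl
any-cong (x ∷ xs) h = cong₂ _∨_ (h x) (any-cong xs h)

all-cong : ∀ {A : Set} {f g : A → Bool} xs → (∀ x → f x ≡ g x) → all f xs ≡ all g xs
all-cong [] h = refl
all-cong (x ∷ xs) h = cong₂ _∧_ (h x) (all-cong xs h)

==⇒ : ∀ {n} {a b : Fin n} → (a == b) ≡ true → a ≡ b
==⇒ {a = a} {b} e = toℕ-injective (≡ᵇ⇒≡ (toℕ a) (toℕ b) (⇒T e))

==-refl : ∀ {n} (a : Fin n) → (a == a) ≡ true
==-refl a = T⇒ (≡⇒≡ᵇ (toℕ a) (toℕ a) refl)

≡ᵇ-t : ∀ {m k} → m ≡ k → (m ≡ᵇ k) ≡ true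
≡ᵇ-t {m} refl = T⇒ (≡⇒≡ᵇ m m refl)

≡ᵇ-f : ∀ {m k} → ¬ m ≡ k → (m ≡ᵇ k) ≡ false
≡ᵇ-f {m} {k} ne = ¬t⇒f (λ h → ne (≡ᵇ⇒≡ m k (⇒T h)))

<ᵇ-t : ∀ {m k} → m < k → (m <ᵇ k) ≡ true
<ᵇ-t lt = T⇒ (<⇒<ᵇ lt)

<ᵇ-f : ∀ {m k} → ¬ m < k → (m <ᵇ k) ≡ false
<ᵇ-f {m} {k} nl = ¬t⇒f (λ h → nl (<ᵇ⇒< m k (⇒T h)))

≤ᵇ-t : ∀ {m k} → m ≤ k → (m ≤ᵇ k) ≡ true
≤ᵇ-t le = T⇒ (≤⇒≤ᵇ le)

≤ᵇ-f : ∀ {m k} → ¬ m ≤ k → (m ≤ᵇ k) ≡ false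
≤ᵇ-f {m} {k} nl = ¬t⇒f (λ h → nl (≤ᵇ⇒≤ m k (⇒T h)))

-- Walks and the connectivity test only depend
-- on the set of edges, and duplicate-free lists with the same elements are
-- permutations of each other, so sums over them agree.

_≈ₛ_ : ∀ {A : Set} → List A → List A → Set
xs ≈ₛ ys = ∀ z → (z ∈ xs → z ∈ ys) × (z ∈ ys → z ∈ xs)

any-≈ : ∀ {A : Set} (f : A → Bool) {xs ys} → xs ≈ₛ ys → any f xs ≡ any f ys
any-≈ f {xs} {ys} eq = bool-ext
  (λ e → let (x , x∈ , fx) = any⇒ f xs e in ⇒any f (proj₁ (eq x) x∈) fx)
  (λ e → let (x , x∈ , fx) = any⇒ f ys e in ⇒any f (proj₂ (eq x) x∈) fx)

all-≈ : ∀ {A : Set} (f : A → Bool) {xs ys} → xs ≈ₛ ys → all f xs ≡ all f ys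
all-≈ f {xs} {ys} eq = bool-ext
  (λ e → ⇒all f ys (λ x x∈ → all⇒ f e (proj₂ (eq x) x∈)))
  (λ e → ⇒all f xs (λ x x∈ → all⇒ f e (proj₁ (eq x) x∈)))

≈-cons : ∀ {A : Set} (x : A) {s s'} → s ≈ₛ s' → (x ∷ s) ≈ₛ (x ∷ s')
≈-cons x eq z = (λ { (here e) → here e ; (there m) → there (proj₁ (eq z) m) })
              , (λ { (here e) → here e ; (there m) → there (proj₂ (eq z) m) })

≈-swap : ∀ {A : Set} (x y : A) s → (x ∷ y ∷ s) ≈ₛ (y ∷ x ∷ s)
≈-swap x y s z = (λ { (here e) → there (here e) ; (there (here e)) → here e ; (there (there m)) → there (there m) })
               , (λ { (here e) → there (here e) ; (there (here e)) → here e ; (there (there m)) → there (there m) })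

unique-perm : ∀ {A : Set} {xs ys : List A} → Unique xs → Unique ys → xs ≈ₛ ys → xs ↭ ys
unique-perm ux uy eq = ∼bag⇒↭ (unique∧set⇒bag ux uy (λ {z} → mk⇔ (proj₁ (eq z)) (proj₂ (eq z))))

-- The key fact is  reach⇒walk≤n : a reachable vertex is reachable by a walk of
-- length at most n, because the set of vertices reachable within k steps can
-- grow at most n times.

EdgeList : ℕ → Set
EdgeList n = List (Fin n × Fin n)

module _ {n : ℕ} where

  joins-sym : (E : EdgeList n) (u v : Fin n) → joins E u v ≡ joins E v u
  joins-sym E u v = any-cong E (λ e → ∨-comm ((proj₁ e == u) ∧ (proj₂ e == v)) ((proj₁ e == v) ∧ (proj₂ e == u)))

  joins⇒ : (E : EdgeList n) {u v : Fin n} → joins E u v ≡ true → (u , v) ∈ E ⊎ (v , u) ∈ E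
  joins⇒ E {u} {v} j with any⇒ _ E j
  ... | (a , b) , e∈ , c with ∨⇒ c
  ... | inj₁ c1 with ∧⇒ c1
  ... | p , q with ==⇒ {a = a} {u} p | ==⇒ {a = b} {v} q
  ... | refl | refl = inj₁ e∈
  joins⇒ E {u} {v} j | (a , b) , e∈ , c | inj₂ c2 with ∧⇒ c2
  ... | p , q with ==⇒ {a = a} {v} p | ==⇒ {a = b} {u} q
  ... | refl | refl = inj₂ e∈

  ⇒joins : (E : EdgeList n) {u v : Fin n} → (u , v) ∈ E → joins E u v ≡ true
  ⇒joins E {u} {v} e∈ = ⇒any (λ e → ((proj₁ e == u) ∧ (proj₂ e == v)) ∨ ((proj₁ e == v) ∧ (proj₂ e == u))) e∈ (∨ˡ _ (⇒∧ (==-refl u) (==-refl v)))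

  ⇒joins' : (E : EdgeList n) {u v : Fin n} → (v , u) ∈ E → joins E u v ≡ true
  ⇒joins' E {u} {v} e∈ = trans (joins-sym E u v) (⇒joins E e∈)

  Walk : ℕ → EdgeList n → Fin n → Fin n → Set
  Walk k E u v = walk≤ k E u v ≡ true

  walk-inv : ∀ k E {u v} → Walk (suc k) E u v → u ≡ v ⊎ ∃ λ w → joins E u w ≡ true × Walk k E w v
  walk-inv k E {u} {v} h with ∨⇒ {u == v} h
  ... | inj₁ e = inj₁ (==⇒ e)
  ... | inj₂ a with any⇒ _ (allFin n) a
  ... | w , _ , c = inj₂ (w , ∧⇒ c)

  walk-step : ∀ k E {u w v} → joins E u w ≡ true → Walk k E w v → Walk (suc k) E u v
  walk-step k E {u} {w} {v} j h = ∨ʳ (u == v) (⇒any (λ x → joins E u x ∧ walk≤ k E x v) (∈-allFin w) (⇒∧ j h))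

  walk-refl : ∀ k E u → Walk k E u u
  walk-refl zero E u = ==-refl u
  walk-refl (suc k) E u = ∨ˡ _ (==-refl u)

  walk-0 : ∀ E {u v} → Walk 0 E u v → u ≡ v
  walk-0 E h = ==⇒ h

  walk-suc : ∀ k E {u v} → Walk k E u v → Walk (suc k) E u v
  walk-suc zero E {u} {v} h with walk-0 E {u} {v} h
  ... | refl = walk-refl 1 E u
  walk-suc (suc k) E {u} {v} h with walk-inv k E {u} {v} h
  ... | inj₁ refl = walk-refl (suc (suc k)) E u
  ... | inj₂ (w , j , h') = walk-step (suc k) E j (walk-suc k E h')

  walk-+ : ∀ d k E {u v} → Walk k E u v → Walk (d + k) E u v
  walk-+ zero k E h = h
  walk-+ (suc d) k E h = walk-suc (d + k) E (walk-+ d k E h)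

  walk-mono : ∀ {k k'} E {u v} → k ≤ k' → Walk k E u v → Walk k' E u v
  walk-mono {k} {k'} E le h = subst (λ t → Walk t E _ _) (m∸n+n≡m le) (walk-+ (k' ∸ k) k E h)

  walk-++ : ∀ j k E {u w v} → Walk j E u w → Walk k E w v → Walk (j + k) E u v
  walk-++ zero k E {u} {w} h1 h2 with walk-0 E {u} {w} h1
  ... | refl = h2
  walk-++ (suc j) k E {u} {w} h1 h2 with walk-inv j E {u} {w} h1
  ... | inj₁ refl = walk-+ (suc j) k E h2
  ... | inj₂ (x , jx , h') = walk-step (j + k) E jx (walk-++ j k E h' h2)

  Reach : EdgeList n → Fin n → Fin n → Set
  Reach E u v = ∃ λ k → Walk k E u v

  reach-refl : ∀ E u → Reach E u u
  reach-refl E u = 0 , walk-refl 0 E u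

  reach-trans : ∀ E {u w v} → Reach E u w → Reach E w v → Reach E u v
  reach-trans E (j , h1) (k , h2) = j + k , walk-++ j k E h1 h2

  reach-edge : ∀ E {u v} → joins E u v ≡ true → Reach E u v
  reach-edge E {u} {v} j = 1 , walk-step 0 E j (walk-refl 0 E v)

  reach-sym : ∀ E {u v} → Reach E u v → Reach E v u
  reach-sym E (k , h) = go k h
    where
    go : ∀ k {u v} → Walk k E u v → Reach E v u
    go zero {u} {v} h with walk-0 E {u} {v} h
    ... | refl = reach-refl E u
    go (suc k) {u} {v} h with walk-inv k E {u} {v} h
    ... | inj₁ refl = reach-refl E u
    ... | inj₂ (w , j , h') = reach-trans E (go k h') (reach-edge E (trans (joins-sym E w u) j))

  card : (Fin n → Bool) → ℕ
  card f = cnt f (allFin n)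

  card≤n : ∀ f → card f ≤ n
  card≤n f = subst (card f ≤_) (length-tabulate (λ i → i)) (go f (allFin n))
    where
    go : ∀ {A : Set} (f : A → Bool) xs → cnt f xs ≤ length xs
    go f [] = z≤n
    go f (x ∷ xs) with f x
    ... | true = s≤s (go f xs)
    ... | false = m≤n⇒m≤1+n (go f xs)

  cnt-mono : ∀ {A : Set} (f g : A → Bool) xs → (∀ x → f x ≡ true → g x ≡ true) → cnt f xs ≤ cnt g xs
  cnt-mono f g [] h = z≤n
  cnt-mono f g (x ∷ xs) h with f x in ef | g x in eg
  ... | true | true = s≤s (cnt-mono f g xs h)
  ... | true | false = ⊥-elim (t≢f (h x ef) eg)
  ... | false | true = m≤n⇒m≤1+n (cnt-mono f g xs h)
  ... | false | false = cnt-mono f g xs h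

  cnt-strict : ∀ {A : Set} (f g : A → Bool) xs {y} → (∀ x → f x ≡ true → g x ≡ true) →
               y ∈ xs → f y ≡ false → g y ≡ true → cnt f xs < cnt g xs
  cnt-strict f g (x ∷ xs) h (here refl) fy gy rewrite fy | gy = s≤s (cnt-mono f g xs h)
  cnt-strict f g (x ∷ xs) h (there y∈) fy gy with f x in ef | g x in eg
  ... | true | true = s≤s (cnt-strict f g xs h y∈ fy gy)
  ... | true | false = ⊥-elim (t≢f (h x ef) eg)
  ... | false | true = m≤n⇒m≤1+n (cnt-strict f g xs h y∈ fy gy)
  ... | false | false = cnt-strict f g xs h y∈ fy gy

  cnt-pos : ∀ {A : Set} (f : A → Bool) xs {y} → y ∈ xs → f y ≡ true → 1 ≤ cnt f xs
  cnt-pos f (x ∷ xs) (here refl) fy rewrite fy = s≤s z≤n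
  cnt-pos f (x ∷ xs) (there y∈) fy = ≤-trans (cnt-pos f xs y∈ fy) (m≤n+m _ (b2n (f x)))

  -- S k is the set of vertices with a walk of length ≤ k to the target v.  The
  -- sets increase with k; once S (suc j) = S j they are constant, and since
  -- each strict increase adds a vertex this happens by k = n.
  module WalkNormalisation (E : EdgeList n) (v : Fin n) where
    S : ℕ → Fin n → Bool
    S k u = walk≤ k E u v

    Stable : ℕ → Set
    Stable j = ∀ u → S (suc j) u ≡ true → S j u ≡ true

    stable-suc : ∀ j → Stable j → Stable (suc j)
    stable-suc j st u h with walk-inv (suc j) E {u} {v} h
    ... | inj₁ refl = walk-refl (suc j) E u
    ... | inj₂ (w , jw , hw) = walk-step j E jw (st w hw)

    stable-down : ∀ j → Stable j → ∀ d u → S (d + j) u ≡ true → S j u ≡ true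
    stable-down j st zero u h = h
    stable-down j st (suc d) u h = stable-down j st d u (stable-+ d u h)
      where
      stable-+ : ∀ d → Stable (d + j)
      stable-+ zero = st
      stable-+ (suc d) = stable-suc (d + j) (stable-+ d)

    grow : ∀ k → (suc k ≤ card (S k)) ⊎ (∃ λ j → j ≤ k × Stable j)
    grow zero = inj₁ (cnt-pos (S 0) (allFin n) (∈-allFin v) (walk-refl 0 E v))
    grow (suc k) with grow k
    ... | inj₂ (j , le , st) = inj₂ (j , m≤n⇒m≤1+n le , st)
    ... | inj₁ c with all (λ u → not (S (suc k) u) ∨ S k u) (allFin n) in eq
    ... | true = inj₂ (k , m≤n⇒m≤1+n ≤-refl , λ u h → shrink u (all⇒ _ eq (∈-allFin u)) h)
      where
      shrink : ∀ u → not (S (suc k) u) ∨ S k u ≡ true → S (suc k) u ≡ true → S k u ≡ true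
      shrink u e h rewrite h = e
    ... | false with all-false _ (allFin n) eq
    ... | u , u∈ , fu = inj₁ (≤-<-trans c (cnt-strict (S k) (S (suc k)) (allFin n) (λ x → walk-suc k E) u∈ (new fu) (old fu)))
      where
      old : ∀ {a b} → not a ∨ b ≡ false → a ≡ true
      old {true} _ = refl
      new : ∀ {a b} → not a ∨ b ≡ false → b ≡ false
      new {true} {false} _ = refl

    normalise : ∀ k u → S k u ≡ true → S n u ≡ true
    normalise k u h with grow n
    ... | inj₁ c = ⊥-elim (n≮n n (≤-trans c (card≤n (S n))))
    ... | inj₂ (j , le , st) with ≤-total k j
    ... | inj₁ k≤j = walk-mono E (≤-trans k≤j le) h
    ... | inj₂ j≤k = walk-mono E le (stable-down j st (k ∸ j) u (subst (λ t → S t u ≡ true) (sym (m∸n+n≡m j≤k)) h))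

  reach⇒walk≤n : ∀ E {u v} → Reach E u v → Walk n E u v
  reach⇒walk≤n E {u} {v} (k , h) = WalkNormalisation.normalise E v k u h

reach-hom : ∀ {m m'} (f : Fin m → Fin m') (E : EdgeList m) (E₂ : EdgeList m') →
            (∀ a b → joins E a b ≡ true → Reach E₂ (f a) (f b)) →
            ∀ {x y} → Reach E x y → Reach E₂ (f x) (f y)
reach-hom f E E₂ H (k , h) = go k h
  where
  go : ∀ k {x y} → Walk k E x y → Reach E₂ (f x) (f y)
  go zero {x} {y} h with walk-0 E {x} {y} h
  ... | refl = reach-refl E₂ (f x)
  go (suc k) {x} {y} h with walk-inv k E {x} {y} h
  ... | inj₁ refl = reach-refl E₂ (f x)
  ... | inj₂ (w , j , h') = reach-trans E₂ (H x w j) (go k h')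

-- The connectivity test as a proposition.  conn V E holds iff V is nonempty,
-- every edge of E has both ends in V, and any two vertices of V are joined in E;
-- by reach⇒walk≤n the length bound n built into Defs imposes no restriction.

conn : ∀ {n} → Vec Bool n → EdgeList n → Bool
conn = isConnectedSubgraph

record Connected {n} (V : Vec Bool n) (E : EdgeList n) : Set where
  constructor connected
  field
    nonempty : ∃ λ u → lookup V u ≡ true
    ends     : ∀ e → e ∈ E → lookup V (proj₁ e) ≡ true × lookup V (proj₂ e) ≡ true
    reach    : ∀ u w → lookup V u ≡ true → lookup V w ≡ true → Reach E u w

module _ {n : ℕ} where

  conn⇒ : (V : Vec Bool n) (E : EdgeList n) → conn V E ≡ true → Connected V E
  conn⇒ V E h with ∧⇒ h
  ... | a , bc with ∧⇒ bc
  ... | b , c = connected nonempty' ends' reach'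
    where
    nonempty' : ∃ λ u → lookup V u ≡ true
    nonempty' with any⇒ (lookup V) (allFin n) a
    ... | u , _ , Vu = u , Vu
    ends' : ∀ e → e ∈ E → lookup V (proj₁ e) ≡ true × lookup V (proj₂ e) ≡ true
    ends' e e∈ = ∧⇒ (all⇒ (λ e → lookup V (proj₁ e) ∧ lookup V (proj₂ e)) b e∈)
    reach' : ∀ u w → lookup V u ≡ true → lookup V w ≡ true → Reach E u w
    reach' u w Vu Vw = n , walk-of (all⇒ (λ w → not (lookup V u ∧ lookup V w) ∨ walk≤ n E u w)
                                     (all⇒ (λ u → all (λ w → not (lookup V u ∧ lookup V w) ∨ walk≤ n E u w) (allFin n)) c (∈-allFin u))
                                     (∈-allFin w))
      where
      walk-of : not (lookup V u ∧ lookup V w) ∨ walk≤ n E u w ≡ true → walk≤ n E u w ≡ true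
      walk-of e rewrite Vu | Vw = e

  ⇒conn : (V : Vec Bool n) (E : EdgeList n) → Connected V E → conn V E ≡ true
  ⇒conn V E (connected (u , Vu) ends reach) =
    ⇒∧ (⇒any (lookup V) (∈-allFin u) Vu)
       (⇒∧ (⇒all _ E (λ e e∈ → let (p , q) = ends e e∈ in ⇒∧ p q))
           (⇒all _ (allFin n) (λ x _ → ⇒all _ (allFin n) (λ y _ → joined x y))))
    where
    joined : ∀ x y → not (lookup V x ∧ lookup V y) ∨ walk≤ n E x y ≡ true
    joined x y with lookup V x in ex | lookup V y in ey
    ... | true | true = reach⇒walk≤n E (reach x y ex ey)
    ... | true | false = refl
    ... | false | _ = refl

  conn-ext : ∀ {V : Vec Bool n} {E} {b : Bool} → (Connected V E → b ≡ true) → (b ≡ true → Connected V E) → conn V E ≡ b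
  conn-ext {V} {E} {b} f g = bool-ext {conn V E} {b} (λ h → f (conn⇒ V E h)) (λ h → ⇒conn V E (g h))

  walk-≈ : ∀ k (E E' : EdgeList n) → E ≈ₛ E' → ∀ u v → walk≤ k E u v ≡ walk≤ k E' u v
  walk-≈ zero E E' eq u v = refl
  walk-≈ (suc k) E E' eq u v =
    cong ((u == v) ∨_) (any-cong (allFin n) (λ w → cong₂ _∧_
      (any-≈ (λ e → ((proj₁ e == u) ∧ (proj₂ e == w)) ∨ ((proj₁ e == w) ∧ (proj₂ e == u))) eq)
      (walk-≈ k E E' eq w v)))

  conn-≈ : (V : Vec Bool n) (E E' : EdgeList n) → E ≈ₛ E' → conn V E ≡ conn V E'
  conn-≈ V E E' eq = cong₂ _∧_ {x = any (lookup V) (allFin n)} refl (cong₂ _∧_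
    (all-≈ (λ e → lookup V (proj₁ e) ∧ lookup V (proj₂ e)) eq)
    (all-cong (allFin n) (λ x → all-cong (allFin n) (λ y → cong (not (lookup V x ∧ lookup V y) ∨_) (walk-≈ n E E' eq x y)))))

-- A graph G' on Fin (suc n) is viewed as a graph G
-- on Fin n (embedded by ι) plus the last vertex ℓ.  A vertex set of G' is
-- v ∷ʳ h (h says whether ℓ is used), and an edge list of G' consists of edges at
-- ℓ followed by the image  map sh s  of an edge list s of G.

ι : ∀ {n} → Fin n → Fin (suc n)
ι = inject₁

ℓ : ∀ {n} → Fin (suc n)
ℓ {n} = fromℕ n

ι≢ℓ : ∀ {n} {i : Fin n} → ι i ≡ ℓ → ⊥
ι≢ℓ e = fromℕ≢inject₁ (sym e)

lookup-ι : ∀ {n} (v : Vec Bool n) h i → lookup (v ∷ʳ h) (ι i) ≡ lookup v i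
lookup-ι (x ∷ᵥ v) h fz = refl
lookup-ι (x ∷ᵥ v) h (fs i) = lookup-ι v h i

lookup-ℓ : ∀ {n} (v : Vec Bool n) h → lookup (v ∷ʳ h) ℓ ≡ h
lookup-ℓ []ᵥ h = refl
lookup-ℓ (x ∷ᵥ v) h = lookup-ℓ v h

lookup-ι⁺ : ∀ {n} (v : Vec Bool n) h i → lookup v i ≡ true → lookup (v ∷ʳ h) (ι i) ≡ true
lookup-ι⁺ v h i e = trans (lookup-ι v h i) e

lookup-ι⁻ : ∀ {n} (v : Vec Bool n) h i → lookup (v ∷ʳ h) (ι i) ≡ true → lookup v i ≡ true
lookup-ι⁻ v h i e = trans (sym (lookup-ι v h i)) e

ℓ-absent : ∀ {n} (v : Vec Bool n) → lookup (v ∷ʳ false) ℓ ≡ true → ⊥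
ℓ-absent v e with trans (sym (lookup-ℓ v false)) e
... | ()

π : ∀ {n} → Fin n → Fin (suc n) → Fin n
π d x with view x
... | ‵fromℕ = d
... | ‵inject₁ i = i

π-ι : ∀ {n} (d i : Fin n) → π d (ι i) ≡ i
π-ι d i rewrite view-inject₁ i = refl

π-ℓ : ∀ {n} (d : Fin n) → π d ℓ ≡ d
π-ℓ {n} d rewrite view-fromℕ n = refl

sh : ∀ {n} → Fin n × Fin n → Fin (suc n) × Fin (suc n)
sh (a , b) = (ι a , ι b)

module _ {n : ℕ} where

  sh-reach : (X : EdgeList (suc n)) (s : EdgeList n) {x y : Fin n} → (x , y) ∈ s → Reach (X ++ map sh s) (ι x) (ι y)
  sh-reach X s m = reach-edge (X ++ map sh s) (⇒joins (X ++ map sh s) (∈-++⁺ʳ X (∈-map⁺ sh m)))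

  reach-ι : (X : EdgeList (suc n)) (s E : EdgeList n) → (∀ x y → (x , y) ∈ E → Reach (X ++ map sh s) (ι x) (ι y)) →
            ∀ {a b} → Reach E a b → Reach (X ++ map sh s) (ι a) (ι b)
  reach-ι X s E H = reach-hom ι E (X ++ map sh s) H'
    where
    H' : ∀ a b → joins E a b ≡ true → Reach (X ++ map sh s) (ι a) (ι b)
    H' a b j with joins⇒ E j
    ... | inj₁ m = H a b m
    ... | inj₂ m = reach-sym (X ++ map sh s) (H b a m)

  reach-π : (X : EdgeList (suc n)) (s E : EdgeList n) (d : Fin n) → (∀ e → e ∈ s → e ∈ E) →
            (∀ x y → (x , y) ∈ X → Reach E (π d x) (π d y)) →
            ∀ {a b} → Reach (X ++ map sh s) a b → Reach E (π d a) (π d b)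
  reach-π X s E d sub HX = reach-hom (π d) (X ++ map sh s) E H'
    where
    edge : ∀ x y → (x , y) ∈ X ++ map sh s → Reach E (π d x) (π d y)
    edge x y m with ∈-++⁻ X m
    ... | inj₁ mx = HX x y mx
    ... | inj₂ ms with ∈-map⁻ sh ms
    ... | (p , q) , pq∈ , refl rewrite π-ι d p | π-ι d q = reach-edge E (⇒joins E (sub (p , q) pq∈))
    H' : ∀ a b → joins (X ++ map sh s) a b ≡ true → Reach E (π d a) (π d b)
    H' a b j with joins⇒ (X ++ map sh s) j
    ... | inj₁ m = edge a b m
    ... | inj₂ m = reach-sym E (edge b a m)

  ends-unsh : ∀ (v : Vec Bool n) h (X : EdgeList (suc n)) (s : EdgeList n) →
              (∀ e → e ∈ X ++ map sh s → lookup (v ∷ʳ h) (proj₁ e) ≡ true × lookup (v ∷ʳ h) (proj₂ e) ≡ true) →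
              ∀ e → e ∈ s → lookup v (proj₁ e) ≡ true × lookup v (proj₂ e) ≡ true
  ends-unsh v h X s ends (p , q) m with ends (ι p , ι q) (∈-++⁺ʳ X (∈-map⁺ sh m))
  ... | a , b rewrite lookup-ι v h p | lookup-ι v h q = a , b

  ends-sh : ∀ (v : Vec Bool n) h (s : EdgeList n) →
            (∀ e → e ∈ s → lookup v (proj₁ e) ≡ true × lookup v (proj₂ e) ≡ true) →
            ∀ e → e ∈ map sh s → lookup (v ∷ʳ h) (proj₁ e) ≡ true × lookup (v ∷ʳ h) (proj₂ e) ≡ true
  ends-sh v h s ends e m with ∈-map⁻ sh m
  ... | (p , q) , pq∈ , refl rewrite lookup-ι v h p | lookup-ι v h q = ends (p , q) pq∈

  allF : Vec Bool n → Bool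
  allF v = all (λ i → not (lookup v i)) (allFin n)

module _ {n : ℕ} where

  conn-ℓ-absent : (v : Vec Bool n) (s : EdgeList n) → conn (v ∷ʳ false) (map sh s) ≡ conn v s
  conn-ℓ-absent v s = conn-ext to from
    where
    to : Connected (v ∷ʳ false) (map sh s) → conn v s ≡ true
    to (connected (x , Vx) ends reach) = ⇒conn v s (connected (nonempty x Vx) (ends-unsh v false [] s ends) reach')
      where
      nonempty : ∀ x → lookup (v ∷ʳ false) x ≡ true → ∃ λ u → lookup v u ≡ true
      nonempty x Vx with view x
      ... | ‵inject₁ i = i , lookup-ι⁻ v false i Vx
      ... | ‵fromℕ = ⊥-elim (ℓ-absent v Vx)
      reach' : ∀ u w → lookup v u ≡ true → lookup v w ≡ true → Reach s u w
      reach' u w vu vw = subst₂ (Reach s) (π-ι u u) (π-ι u w)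
        (reach-π [] s s u (λ e m → m) (λ x y ()) (reach (ι u) (ι w) (lookup-ι⁺ v false u vu) (lookup-ι⁺ v false w vw)))
    from : conn v s ≡ true → Connected (v ∷ʳ false) (map sh s)
    from h with conn⇒ v s h
    ... | connected (u , vu) ends reach = connected (ι u , lookup-ι⁺ v false u vu) (ends-sh v false s ends) reach'
      where
      reach' : ∀ x y → lookup (v ∷ʳ false) x ≡ true → lookup (v ∷ʳ false) y ≡ true → Reach (map sh s) x y
      reach' x y Vx Vy with view x | view y
      ... | ‵fromℕ | _ = ⊥-elim (ℓ-absent v Vx)
      ... | ‵inject₁ i | ‵fromℕ = ⊥-elim (ℓ-absent v Vy)
      ... | ‵inject₁ i | ‵inject₁ j = reach-ι [] s s (λ x y m → sh-reach [] s m) (reach i j (lookup-ι⁻ v false i Vx) (lookup-ι⁻ v false j Vy))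

  -- ℓ unused but an edge at ℓ used: never connected (the edge needs its end ℓ)
  conn-ℓ-absent-edge : (v : Vec Bool n) (x : Fin (suc n)) (L : EdgeList (suc n)) → conn (v ∷ʳ false) ((x , ℓ) ∷ L) ≡ false
  conn-ℓ-absent-edge v x L = ¬t⇒f (λ h → ℓ-absent v (proj₂ (Connected.ends (conn⇒ (v ∷ʳ false) ((x , ℓ) ∷ L) h) (x , ℓ) (here refl))))

  stuck-at-ℓ : ∀ (s : EdgeList n) k {y} → Walk k (map sh s) ℓ y → y ≡ ℓ
  stuck-at-ℓ s zero {y} h = sym (walk-0 (map sh s) {ℓ} {y} h)
  stuck-at-ℓ s (suc k) {y} h with walk-inv k (map sh s) {ℓ} {y} h
  ... | inj₁ e = sym e
  ... | inj₂ (w , j , h') with joins⇒ (map sh s) j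
  ... | inj₁ m with ∈-map⁻ sh m
  ... | _ , _ , e = ⊥-elim (ι≢ℓ (sym (cong proj₁ e)))
  stuck-at-ℓ s (suc k) {y} h | inj₂ (w , j , h') | inj₂ m with ∈-map⁻ sh m
  ... | _ , _ , e = ⊥-elim (ι≢ℓ (sym (cong proj₂ e)))

  conn-ℓ-isolated : (v : Vec Bool n) (s : EdgeList n) → conn (v ∷ʳ true) (map sh s) ≡ allF v ∧ null s
  conn-ℓ-isolated v s = conn-ext to from
    where
    to : Connected (v ∷ʳ true) (map sh s) → allF v ∧ null s ≡ true
    to (connected _ ends reach) = ⇒∧ v-empty (s-empty s ends)
      where
      unused : ∀ i → lookup v i ≡ false
      unused i with lookup v i in eq
      ... | false = refl
      ... | true with reach ℓ (ι i) (lookup-ℓ v true) (lookup-ι⁺ v true i eq)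
      ... | k , w = ⊥-elim (ι≢ℓ (stuck-at-ℓ s k w))
      v-empty : allF v ≡ true
      v-empty = ⇒all _ (allFin n) (λ i _ → cong not (unused i))
      s-empty : ∀ s → (∀ e → e ∈ map sh s → lookup (v ∷ʳ true) (proj₁ e) ≡ true × lookup (v ∷ʳ true) (proj₂ e) ≡ true) → null s ≡ true
      s-empty [] _ = refl
      s-empty ((p , q) ∷ s) ends' with trans (sym (unused p)) (lookup-ι⁻ v true p (proj₁ (ends' _ (here refl))))
      ... | ()
    from : allF v ∧ null s ≡ true → Connected (v ∷ʳ true) (map sh s)
    from = from' s
      where
      unused : allF v ≡ true → ∀ i → lookup (v ∷ʳ true) (ι i) ≡ true → ⊥
      unused af i e with trans (sym (lookup-ι⁻ v true i e)) (not⇒ (all⇒ (λ i → not (lookup v i)) af (∈-allFin i)))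
      ... | ()
      from' : ∀ s' → allF v ∧ null s' ≡ true → Connected (v ∷ʳ true) (map sh s')
      from' (_ ∷ _) h with ∧⇒ {allF v} h
      ... | _ , ()
      from' [] h with ∧⇒ {allF v} h
      ... | af , _ = connected (ℓ , lookup-ℓ v true) (λ e ()) reach'
        where
        reach' : ∀ x y → lookup (v ∷ʳ true) x ≡ true → lookup (v ∷ʳ true) y ≡ true → Reach [] x y
        reach' x y Vx Vy with view x | view y
        ... | ‵inject₁ i | _ = ⊥-elim (unused af i Vx)
        ... | ‵fromℕ | ‵inject₁ j = ⊥-elim (unused af j Vy)
        ... | ‵fromℕ | ‵fromℕ = reach-refl [] ℓ

  conn-ℓ-pendant : (v : Vec Bool n) (r : Fin n) (s : EdgeList n) →
                   conn (v ∷ʳ true) ((ι r , ℓ) ∷ map sh s) ≡ conn v s ∧ lookup v r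
  conn-ℓ-pendant v r s = conn-ext to from
    where
    X : EdgeList (suc n)
    X = (ι r , ℓ) ∷ []
    to : Connected (v ∷ʳ true) ((ι r , ℓ) ∷ map sh s) → conn v s ∧ lookup v r ≡ true
    to (connected _ ends reach) = ⇒∧ (⇒conn v s (connected (r , vr) (ends-unsh v true X s ends) reach')) vr
      where
      vr : lookup v r ≡ true
      vr = lookup-ι⁻ v true r (proj₁ (ends _ (here refl)))
      HX : ∀ x y → (x , y) ∈ X → Reach s (π r x) (π r y)
      HX x y (here refl) rewrite π-ι r r | π-ℓ r = reach-refl s r
      reach' : ∀ u w → lookup v u ≡ true → lookup v w ≡ true → Reach s u w
      reach' u w vu vw = subst₂ (Reach s) (π-ι r u) (π-ι r w)
        (reach-π X s s r (λ e m → m) HX (reach (ι u) (ι w) (lookup-ι⁺ v true u vu) (lookup-ι⁺ v true w vw)))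
    from : conn v s ∧ lookup v r ≡ true → Connected (v ∷ʳ true) ((ι r , ℓ) ∷ map sh s)
    from h with ∧⇒ {conn v s} h
    ... | c , vr with conn⇒ v s c
    ... | connected _ ends reach = connected (ℓ , lookup-ℓ v true) ends' reach'
      where
      E' : EdgeList (suc n)
      E' = (ι r , ℓ) ∷ map sh s
      ends' : ∀ e → e ∈ E' → lookup (v ∷ʳ true) (proj₁ e) ≡ true × lookup (v ∷ʳ true) (proj₂ e) ≡ true
      ends' _ (here refl) = lookup-ι⁺ v true r vr , lookup-ℓ v true
      ends' e (there m) = ends-sh v true s ends e m
      toℓ : ∀ i → lookup v i ≡ true → Reach E' (ι i) ℓ
      toℓ i vi = reach-trans E' (reach-ι X s s (λ x y m → sh-reach X s m) (reach i r vi vr)) (reach-edge E' (⇒joins E' (here refl)))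
      reach' : ∀ x y → lookup (v ∷ʳ true) x ≡ true → lookup (v ∷ʳ true) y ≡ true → Reach E' x y
      reach' x y Vx Vy with view x | view y
      ... | ‵inject₁ i | ‵inject₁ j = reach-ι X s s (λ x y m → sh-reach X s m) (reach i j (lookup-ι⁻ v true i Vx) (lookup-ι⁻ v true j Vy))
      ... | ‵inject₁ i | ‵fromℕ = toℓ i (lookup-ι⁻ v true i Vx)
      ... | ‵fromℕ | ‵inject₁ j = reach-sym E' (toℓ j (lookup-ι⁻ v true j Vy))
      ... | ‵fromℕ | ‵fromℕ = reach-refl E' ℓ

  -- ℓ used with both edges aℓ and bℓ: the path a – ℓ – b acts as the edge ab
  module _ (v : Vec Bool n) (a b : Fin n) (s : EdgeList n) where
    private
      X E' : EdgeList (suc n)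
      X = (ι a , ℓ) ∷ (ι b , ℓ) ∷ []
      E' = (ι a , ℓ) ∷ (ι b , ℓ) ∷ map sh s
      E : EdgeList n
      E = (a , b) ∷ s

    subdivided⇒ : Connected (v ∷ʳ true) E' → Connected v E
    subdivided⇒ (connected _ ends reach) = connected (a , va) ends' reach'
      where
      va : lookup v a ≡ true
      va = lookup-ι⁻ v true a (proj₁ (ends _ (here refl)))
      vb : lookup v b ≡ true
      vb = lookup-ι⁻ v true b (proj₁ (ends _ (there (here refl))))
      ends' : ∀ e → e ∈ E → lookup v (proj₁ e) ≡ true × lookup v (proj₂ e) ≡ true
      ends' _ (here refl) = va , vb
      ends' e (there m) = ends-unsh v true X s ends e m
      HX : ∀ x y → (x , y) ∈ X → Reach E (π a x) (π a y)
      HX x y (here refl) rewrite π-ι a a | π-ℓ a = reach-refl E a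
      HX x y (there (here refl)) rewrite π-ι a b | π-ℓ a = reach-sym E (reach-edge E (⇒joins E (here refl)))
      reach' : ∀ u w → lookup v u ≡ true → lookup v w ≡ true → Reach E u w
      reach' u w vu vw = subst₂ (Reach E) (π-ι a u) (π-ι a w)
        (reach-π X s E a (λ e m → there m) HX (reach (ι u) (ι w) (lookup-ι⁺ v true u vu) (lookup-ι⁺ v true w vw)))

    subdivided⇐ : Connected v E → Connected (v ∷ʳ true) E'
    subdivided⇐ (connected _ ends reach) = connected (ℓ , lookup-ℓ v true) ends' reach'
      where
      va : lookup v a ≡ true
      va = proj₁ (ends _ (here refl))
      vb : lookup v b ≡ true
      vb = proj₂ (ends _ (here refl))
      ends' : ∀ e → e ∈ E' → lookup (v ∷ʳ true) (proj₁ e) ≡ true × lookup (v ∷ʳ true) (proj₂ e) ≡ true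
      ends' _ (here refl) = lookup-ι⁺ v true a va , lookup-ℓ v true
      ends' _ (there (here refl)) = lookup-ι⁺ v true b vb , lookup-ℓ v true
      ends' e (there (there m)) = ends-sh v true s (λ e m → ends e (there m)) e m
      H : ∀ x y → (x , y) ∈ E → Reach E' (ι x) (ι y)
      H x y (here refl) = reach-trans E' (reach-edge E' (⇒joins E' (here refl))) (reach-edge E' (⇒joins' E' (there (here refl))))
      H x y (there m) = sh-reach X s m
      toℓ : ∀ i → lookup v i ≡ true → Reach E' (ι i) ℓ
      toℓ i vi = reach-trans E' (reach-ι X s E H (reach i a vi va)) (reach-edge E' (⇒joins E' (here refl)))
      reach' : ∀ x y → lookup (v ∷ʳ true) x ≡ true → lookup (v ∷ʳ true) y ≡ true → Reach E' x y
      reach' x y Vx Vy with view x | view y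
      ... | ‵inject₁ i | ‵inject₁ j = reach-ι X s E H (reach i j (lookup-ι⁻ v true i Vx) (lookup-ι⁻ v true j Vy))
      ... | ‵inject₁ i | ‵fromℕ = toℓ i (lookup-ι⁻ v true i Vx)
      ... | ‵fromℕ | ‵inject₁ j = reach-sym E' (toℓ j (lookup-ι⁻ v true j Vy))
      ... | ‵fromℕ | ‵fromℕ = reach-refl E' ℓ

  conn-ℓ-subdivides : (v : Vec Bool n) (a b : Fin n) (s : EdgeList n) →
                      conn (v ∷ʳ true) ((ι a , ℓ) ∷ (ι b , ℓ) ∷ map sh s) ≡ conn v ((a , b) ∷ s)
  conn-ℓ-subdivides v a b s = conn-ext (⇒conn v _ ∘ subdivided⇒ v a b s) (subdivided⇐ v a b s ∘ conn⇒ v _)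

subsets-complete : ∀ {n} (V : Vec Bool n) → V ∈ subsets n
subsets-complete []ᵥ = here refl
subsets-complete {suc n} (b ∷ᵥ V) = ∈-concatMap⁺ (λ v → (false ∷ᵥ v) ∷ (true ∷ᵥ v) ∷ []) (Any.map (λ { refl → head b }) (subsets-complete V))
  where
  head : ∀ b → (b ∷ᵥ V) ∈ (false ∷ᵥ V) ∷ (true ∷ᵥ V) ∷ []
  head false = here refl
  head true = there (here refl)

subsets-unique : ∀ n → Unique (subsets n)
subsets-unique zero = [] ∷ []
subsets-unique (suc n) = go (subsets n) (subsets-unique n)
  where
  h : Vec Bool n → List (Vec Bool (suc n))
  h v = (false ∷ᵥ v) ∷ (true ∷ᵥ v) ∷ []
  fresh : ∀ {x} xs → ¬ (x ∈ xs) → ∀ b → All (λ z → ¬ (b ∷ᵥ x) ≡ z) (concatMap h xs)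
  fresh {x} xs nx b = All.tabulate λ {z} m e → nx (tail-∈ z m e)
    where
    tail-∈ : ∀ z → z ∈ concatMap h xs → (b ∷ᵥ x) ≡ z → x ∈ xs
    tail-∈ z m refl = Any.map (λ { {y} (here e) → ∷-injectiveʳ e ; {y} (there (here e)) → ∷-injectiveʳ e }) (∈-concatMap⁻ h {xs = xs} m)
  go : ∀ xs → Unique xs → Unique (concatMap h xs)
  go [] _ = []
  go (x ∷ xs) (px ∷ u) = ((λ ()) ∷ fresh xs nx false) ∷ (fresh xs nx true ∷ go xs u)
    where
    nx : ¬ (x ∈ xs)
    nx m = All.lookup px m refl

sum-subsets-snoc : ∀ {n} (f : Vec Bool (suc n) → ℕ) →
                   sumL f (subsets (suc n)) ≡ sumL (λ v → f (v ∷ʳ false) + f (v ∷ʳ true)) (subsets n)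
sum-subsets-snoc {zero} f = trans (cong (f (false ∷ᵥ []ᵥ) +_) (+-identityʳ _)) (sym (+-identityʳ _))
sum-subsets-snoc {suc n} f = begin
    sumL f (subsets (suc (suc n)))
  ≡⟨ sumL-concatMap f _ (subsets (suc n)) ⟩
    sumL (λ w → f (false ∷ᵥ w) + (f (true ∷ᵥ w) + 0)) (subsets (suc n))
  ≡⟨ sum-subsets-snoc {n} (λ w → f (false ∷ᵥ w) + (f (true ∷ᵥ w) + 0)) ⟩
    sumL (λ v → (f (false ∷ᵥ (v ∷ʳ false)) + (f (true ∷ᵥ (v ∷ʳ false)) + 0)) + (f (false ∷ᵥ (v ∷ʳ true)) + (f (true ∷ᵥ (v ∷ʳ true)) + 0))) (subsets n)
  ≡⟨ sumL-cong (subsets n) (λ v _ → regroup (f (false ∷ᵥ (v ∷ʳ false))) (f (true ∷ᵥ (v ∷ʳ false))) (f (false ∷ᵥ (v ∷ʳ true))) (f (true ∷ᵥ (v ∷ʳ true)))) ⟩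
    sumL (λ w → (f (false ∷ᵥ (w ∷ʳ false)) + f (false ∷ᵥ (w ∷ʳ true))) + ((f (true ∷ᵥ (w ∷ʳ false)) + f (true ∷ᵥ (w ∷ʳ true))) + 0)) (subsets n)
  ≡⟨ sym (sumL-concatMap (λ v → f (v ∷ʳ false) + f (v ∷ʳ true)) _ (subsets n)) ⟩
    sumL (λ v → f (v ∷ʳ false) + f (v ∷ʳ true)) (subsets (suc n)) ∎
  where
  open ≡-Reasoning
  regroup : ∀ a b c d → (a + (b + 0)) + (c + (d + 0)) ≡ (a + c) + ((b + d) + 0)
  regroup = solve-∀

cnt-sublists-∷ : ∀ {A : Set} (p : List A → Bool) x xs →
                 cnt p (sublists (x ∷ xs)) ≡ cnt p (sublists xs) + cnt (λ s → p (x ∷ s)) (sublists xs)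
cnt-sublists-∷ p x xs = trans (sumL-concatMap (b2n ∘ p) _ (sublists xs)) (trans
  (sumL-cong (sublists xs) (λ s _ → cong (b2n (p s) +_) (+-identityʳ _)))
  (sumL-+ (b2n ∘ p) (λ s → b2n (p (x ∷ s))) (sublists xs)))

sublists-map : ∀ {A B : Set} (f : A → B) xs → sublists (map f xs) ≡ map (map f) (sublists xs)
sublists-map f [] = refl
sublists-map f (x ∷ xs) rewrite sublists-map f xs = go (sublists xs)
  where
  go : ∀ ss → concatMap (λ s → s ∷ (f x ∷ s) ∷ []) (map (map f) ss) ≡ map (map f) (concatMap (λ s → s ∷ (x ∷ s) ∷ []) ss)
  go [] = refl
  go (s ∷ ss) = cong (λ t → map f s ∷ (f x ∷ map f s) ∷ t) (go ss)

cnt-sublists-map : ∀ {A B : Set} (p : List B → Bool) (f : A → B) xs →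
                   cnt p (sublists (map f xs)) ≡ cnt (λ s → p (map f s)) (sublists xs)
cnt-sublists-map p f xs rewrite sublists-map f xs = sumL-map (b2n ∘ p) (map f) (sublists xs)

SetInvariant : ∀ {A : Set} → (List A → Bool) → Set
SetInvariant p = ∀ s s' → s ≈ₛ s' → p s ≡ p s'

cnt-sublists-↭ : ∀ {A : Set} (p : List A → Bool) → SetInvariant p → ∀ {xs ys} → xs ↭ ys →
                 cnt p (sublists xs) ≡ cnt p (sublists ys)
cnt-sublists-↭ p inv _↭_.refl = refl
cnt-sublists-↭ p inv {x ∷ xs} {.x ∷ ys} (_↭_.prep x q) = trans (cnt-sublists-∷ p x xs) (trans
  (cong₂ _+_ (cnt-sublists-↭ p inv q) (cnt-sublists-↭ (λ s → p (x ∷ s)) (λ s s' e → inv _ _ (≈-cons x e)) q))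
  (sym (cnt-sublists-∷ p x ys)))
cnt-sublists-↭ p inv {x ∷ y ∷ xs} {.y ∷ .x ∷ ys} (_↭_.swap x y q) = begin
    cnt p (sublists (x ∷ y ∷ xs))
  ≡⟨ cnt-sublists-∷ p x (y ∷ xs) ⟩
    cnt p (sublists (y ∷ xs)) + cnt px (sublists (y ∷ xs))
  ≡⟨ cong₂ _+_ (cnt-sublists-∷ p y xs) (cnt-sublists-∷ px y xs) ⟩
    (cnt p (sublists xs) + cnt py (sublists xs)) + (cnt px (sublists xs) + cnt (λ s → p (x ∷ y ∷ s)) (sublists xs))
  ≡⟨ cong₂ _+_ (cong₂ _+_ (cnt-sublists-↭ p inv q) (cnt-sublists-↭ py invy q)) (cong₂ _+_ (cnt-sublists-↭ px invx q)
        (trans (cnt-cong (sublists xs) (λ s _ → inv _ _ (≈-swap x y s))) (cnt-sublists-↭ (λ s → p (y ∷ x ∷ s)) (λ s s' e → inv _ _ (≈-cons y (≈-cons x e))) q))) ⟩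
    (cnt p (sublists ys) + cnt py (sublists ys)) + (cnt px (sublists ys) + cnt (λ s → p (y ∷ x ∷ s)) (sublists ys))
  ≡⟨ +-+-interchange (cnt p (sublists ys)) (cnt py (sublists ys)) (cnt px (sublists ys)) (cnt (λ s → p (y ∷ x ∷ s)) (sublists ys)) ⟩
    (cnt p (sublists ys) + cnt px (sublists ys)) + (cnt py (sublists ys) + cnt (λ s → p (y ∷ x ∷ s)) (sublists ys))
  ≡⟨ sym (cong₂ _+_ (cnt-sublists-∷ p x ys) (cnt-sublists-∷ py x ys)) ⟩
    cnt p (sublists (x ∷ ys)) + cnt py (sublists (x ∷ ys))
  ≡⟨ sym (cnt-sublists-∷ p y (x ∷ ys)) ⟩
    cnt p (sublists (y ∷ x ∷ ys)) ∎
  where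
  open ≡-Reasoning
  px py : List _ → Bool
  px s = p (x ∷ s)
  py s = p (y ∷ s)
  invx : SetInvariant px
  invx s s' e = inv _ _ (≈-cons x e)
  invy : SetInvariant py
  invy s s' e = inv _ _ (≈-cons y e)
  +-+-interchange : ∀ a b c d → (a + b) + (c + d) ≡ (a + c) + (b + d)
  +-+-interchange = solve-∀
cnt-sublists-↭ p inv (_↭_.trans q r) = trans (cnt-sublists-↭ p inv q) (cnt-sublists-↭ p inv r)

cnt-sublists-null : ∀ {A : Set} (c : Bool) (xs : List A) → cnt (λ s → c ∧ null s) (sublists xs) ≡ b2n c
cnt-sublists-null c [] rewrite ∧-identityʳ c = +-identityʳ _
cnt-sublists-null c (x ∷ xs) = trans (cnt-sublists-∷ _ x xs) (trans (cong₂ _+_ (cnt-sublists-null c xs)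
  (trans (cnt-cong (sublists xs) (λ s _ → ∧-zeroʳ c)) (cnt-false (sublists xs)))) (+-identityʳ _))

pairs : ∀ n → EdgeList n
pairs n = concatMap (λ i → map (λ j → (i , j)) (allFin n)) (allFin n)

pairs≡cartesianProduct : ∀ {A : Set} (xs ys : List A) → concatMap (λ i → map (λ j → (i , j)) ys) xs ≡ cartesianProduct xs ys
pairs≡cartesianProduct [] ys = refl
pairs≡cartesianProduct (x ∷ xs) ys = cong (map (λ j → (x , j)) ys ++_) (pairs≡cartesianProduct xs ys)

isEdge : ∀ {n} → Graph n → Fin n × Fin n → Bool
isEdge G p = (toℕ (proj₁ p) <ᵇ toℕ (proj₂ p)) ∧ adj G (proj₁ p) (proj₂ p)

edges-unique : ∀ {n} (G : Graph n) → Unique (edges G)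
edges-unique {n} G = filter⁺ (T? ∘ isEdge G) (subst Unique (sym (pairs≡cartesianProduct (allFin n) (allFin n))) (cartesianProduct⁺ (allFin⁺ n) (allFin⁺ n)))

edges⇒ : ∀ {n} (G : Graph n) {e} → e ∈ edges G → isEdge G e ≡ true
edges⇒ {n} G m = T⇒ (proj₂ (∈-filter⁻ (T? ∘ isEdge G) {xs = pairs n} m))

⇒edges : ∀ {n} (G : Graph n) {e} → isEdge G e ≡ true → e ∈ edges G
⇒edges {n} G {i , j} h = ∈-filter⁺ (T? ∘ isEdge G) {xs = pairs n}
  (subst ((i , j) ∈_) (sym (pairs≡cartesianProduct (allFin n) (allFin n))) (∈-cartesianProduct⁺ (∈-allFin i) (∈-allFin j))) (⇒T h)

∅ : ∀ {n} → Fin n → Bool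
∅ _ = false

contains : ∀ {n} → (Fin n → Bool) → Vec Bool n → Bool
contains {n} R V = all (λ j → not (R j) ∨ lookup V j) (allFin n)

isEmpty : ∀ {n} → (Fin n → Bool) → Bool
isEmpty {n} R = all (λ j → not (R j)) (allFin n)

Fwith : ∀ {n} → Graph n → (Fin n → Bool) → ℕ
Fwith {n} G R = sumL (λ V → cnt (λ E → conn V E ∧ contains R V) (sublists (edges G))) (subsets n)

F-as-sum : ∀ {n} (G : Graph n) → F G ≡ sumL (λ V → cnt (conn V) (sublists (edges G))) (subsets n)
F-as-sum {n} G = trans (length-filterᵇ P (concatMap (λ V → map (λ E → (V , E)) (sublists (edges G))) (subsets n)))
  (trans (sumL-concatMap (b2n ∘ P) _ (subsets n)) (sumL-cong (subsets n) (λ V _ → sumL-map (b2n ∘ P) _ (sublists (edges G)))))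
  where
  P : Vec Bool n × EdgeList n → Bool
  P p = isConnectedSubgraph (proj₁ p) (proj₂ p)

F≡Fwith∅ : ∀ {n} (G : Graph n) → F G ≡ Fwith G ∅
F≡Fwith∅ {n} G = trans (F-as-sum G) (sumL-cong (subsets n) (λ V _ → cnt-cong (sublists (edges G))
  (λ E _ → sym (trans (cong (conn V E ∧_) (all-true (allFin n))) (∧-identityʳ _)))))

Fwith-cong : ∀ {n} (G : Graph n) {R R₂ : Fin n → Bool} → (∀ j → R j ≡ R₂ j) → Fwith G R ≡ Fwith G R₂
Fwith-cong {n} G eq = sumL-cong (subsets n) (λ V _ → cnt-cong (sublists (edges G))
  (λ E _ → cong (conn V E ∧_) (all-cong (allFin n) (λ j → cong (λ t → not t ∨ lookup V j) (eq j)))))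

isEmpty-cong : ∀ {n} {R R₂ : Fin n → Bool} → (∀ j → R j ≡ R₂ j) → isEmpty R ≡ isEmpty R₂
isEmpty-cong {n} eq = all-cong (allFin n) (λ j → cong not (eq j))

isEmpty-∅ : ∀ {n} → isEmpty {n} ∅ ≡ true
isEmpty-∅ {n} = all-true (allFin n)

all-fz : ∀ {n} (f : Fin (suc n) → Bool) → all f (allFin (suc n)) ≡ f fz ∧ all (f ∘ fs) (allFin n)
all-fz {n} f = cong (f fz ∧_) (cong and (trans (map-tabulate fs f) (sym (map-tabulate id (f ∘ fs)))))

all-ℓ : ∀ {n} (f : Fin (suc n) → Bool) → all f (allFin (suc n)) ≡ all (f ∘ ι) (allFin n) ∧ f ℓ
all-ℓ {n} f = bool-ext
  (λ h → ⇒∧ (⇒all (f ∘ ι) (allFin n) (λ i _ → all⇒ f h (∈-allFin (ι i)))) (all⇒ f h (∈-allFin ℓ)))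
  (λ h → let (a , b) = ∧⇒ h in ⇒all f (allFin (suc n)) (λ x _ → at x a b))
  where
  at : ∀ x → all (f ∘ ι) (allFin n) ≡ true → f ℓ ≡ true → f x ≡ true
  at x a b with view x
  ... | ‵inject₁ i = all⇒ (f ∘ ι) a (∈-allFin i)
  ... | ‵fromℕ = b

contains-snoc : ∀ {n} (R' : Fin (suc n) → Bool) (v : Vec Bool n) h →
                contains R' (v ∷ʳ h) ≡ contains (R' ∘ ι) v ∧ (not (R' ℓ) ∨ h)
contains-snoc {n} R' v h = trans (all-ℓ (λ j → not (R' j) ∨ lookup (v ∷ʳ h) j)) (cong₂ _∧_
  (all-cong (allFin n) (λ i → cong (not (R' (ι i)) ∨_) (lookup-ι v h i)))
  (cong (not (R' ℓ) ∨_) (lookup-ℓ v h)))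

contains-∪ : ∀ {n} (R : Fin n → Bool) (r : Fin n) (v : Vec Bool n) →
             contains (λ j → R j ∨ (j == r)) v ≡ contains R v ∧ lookup v r
contains-∪ {n} R r v = bool-ext
  (λ h → ⇒∧ (⇒all _ (allFin n) (λ j _ → drop-r j (all⇒ _ h (∈-allFin j))))
            (at-r (all⇒ _ h (∈-allFin r))))
  (λ h → let (a , b) = ∧⇒ h in ⇒all _ (allFin n) (λ j _ → add-r j (all⇒ _ a (∈-allFin j)) b))
  where
  drop-r : ∀ j → not (R j ∨ (j == r)) ∨ lookup v j ≡ true → not (R j) ∨ lookup v j ≡ true
  drop-r j e with R j | lookup v j
  ... | true | true = refl
  ... | false | _ = refl
  at-r : not (R r ∨ (r == r)) ∨ lookup v r ≡ true → lookup v r ≡ true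
  at-r e rewrite ==-refl r with R r | lookup v r
  ... | true | y = e
  ... | false | y = e
  add-r : ∀ j → not (R j) ∨ lookup v j ≡ true → lookup v r ≡ true → not (R j ∨ (j == r)) ∨ lookup v j ≡ true
  add-r j e vr with j == r in eq
  ... | true rewrite ==⇒ {a = j} {r} eq | vr = ∨ʳ _ refl
  ... | false with R j | lookup v j
  ... | true | true = refl
  ... | false | _ = refl
  ... | true | false = e

-- only the empty vertex set passes allF
sum-allF : ∀ {n} (q : Vec Bool n → Bool) → sumL (λ v → b2n (allF v ∧ q v)) (subsets n) ≡ b2n (q (replicate n false))
sum-allF {zero} q = +-identityʳ _
sum-allF {suc n} q = begin
    sumL (λ v → b2n (allF v ∧ q v)) (subsets (suc n))
  ≡⟨ sumL-concatMap _ _ (subsets n) ⟩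
    sumL (λ v → b2n (allF (false ∷ᵥ v) ∧ q (false ∷ᵥ v)) + (b2n (allF (true ∷ᵥ v) ∧ q (true ∷ᵥ v)) + 0)) (subsets n)
  ≡⟨ sumL-cong (subsets n) (λ v _ → trans (cong₂ _+_ (cong (λ t → b2n (t ∧ q (false ∷ᵥ v))) (allF-∷ false v))
                                                    (cong (λ t → b2n (t ∧ q (true ∷ᵥ v)) + 0) (allF-∷ true v)))
                                           (+-identityʳ _)) ⟩
    sumL (λ v → b2n (allF v ∧ q (false ∷ᵥ v))) (subsets n)
  ≡⟨ sum-allF (λ v → q (false ∷ᵥ v)) ⟩
    b2n (q (replicate (suc n) false)) ∎
  where
  open ≡-Reasoning
  allF-∷ : ∀ h (v : Vec Bool n) → allF (h ∷ᵥ v) ≡ not h ∧ allF v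
  allF-∷ h v = all-fz (λ i → not (lookup (h ∷ᵥ v) i))

contains-empty : ∀ {n} (R : Fin n → Bool) → contains R (replicate n false) ≡ isEmpty R
contains-empty {n} R = all-cong (allFin n) (λ j → trans (cong (not (R j) ∨_) (lookup-replicate j false)) (∨-identityʳ (not (R j))))

module _ {n : ℕ} where

  isEdge-sh : (G' : Graph (suc n)) (G : Graph n) → (∀ i j → adj G' (ι i) (ι j) ≡ adj G i j) →
              ∀ i j → isEdge G' (ι i , ι j) ≡ isEdge G (i , j)
  isEdge-sh G' G P1 i j rewrite toℕ-inject₁ i | toℕ-inject₁ j | P1 i j = refl

  sh-injective : ∀ {x y : Fin n × Fin n} → sh x ≡ sh y → x ≡ y
  sh-injective {a , b} {c , d} e = cong₂ _,_ (inject₁-injective (cong proj₁ e)) (inject₁-injective (cong proj₂ e))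

  edges-snoc : (G' : Graph (suc n)) (G : Graph n) (A : List (Fin n)) → Unique A →
               (∀ i j → adj G' (ι i) (ι j) ≡ adj G i j) →
               (∀ i → adj G' (ι i) ℓ ≡ true → i ∈ A) → (∀ i → i ∈ A → adj G' (ι i) ℓ ≡ true) →
               edges G' ↭ map (λ a → (ι a , ℓ)) A ++ map sh (edges G)
  edges-snoc G' G A uA P1 P2 P3 = unique-perm (edges-unique G') unique-rhs same
    where
    f : Fin n → Fin (suc n) × Fin (suc n)
    f a = (ι a , ℓ)
    unique-rhs : Unique (map f A ++ map sh (edges G))
    unique-rhs = ++⁺ (map⁺ (λ e → inject₁-injective (cong proj₁ e)) uA) (map⁺ sh-injective (edges-unique G)) disjoint
      where
      disjoint : ∀ {v} → ¬ (v ∈ map f A × v ∈ map sh (edges G))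
      disjoint (m1 , m2) with ∈-map⁻ f m1 | ∈-map⁻ sh m2
      ... | a , _ , refl | (p , q) , _ , e = ι≢ℓ (sym (cong proj₂ e))
    ℓ-last : ∀ (y : Fin (suc n)) → (toℕ (ℓ {n}) <ᵇ toℕ y) ≡ true → ⊥
    ℓ-last y h = <-irrefl refl (<-≤-trans (<ᵇ⇒< _ _ (⇒T h)) (subst (toℕ y ≤_) (sym (toℕ-fromℕ n)) (≤-pred (toℕ<n y))))
    same : edges G' ≈ₛ (map f A ++ map sh (edges G))
    same (x , y) = to , from
      where
      to : (x , y) ∈ edges G' → (x , y) ∈ map f A ++ map sh (edges G)
      to m with edges⇒ G' m
      ... | h with view x | view y
      ... | ‵fromℕ | _ = ⊥-elim (ℓ-last y (proj₁ (∧⇒ h)))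
      ... | ‵inject₁ i | ‵inject₁ j = ∈-++⁺ʳ (map f A) (∈-map⁺ sh (⇒edges G (trans (sym (isEdge-sh G' G P1 i j)) h)))
      ... | ‵inject₁ i | ‵fromℕ = ∈-++⁺ˡ (∈-map⁺ f (P2 i (proj₂ (∧⇒ {toℕ (ι i) <ᵇ toℕ (ℓ {n})} h))))
      from : (x , y) ∈ map f A ++ map sh (edges G) → (x , y) ∈ edges G'
      from m with ∈-++⁻ (map f A) m
      ... | inj₁ m1 with ∈-map⁻ f m1
      ... | i , i∈ , refl = ⇒edges G' (⇒∧ lt (P3 i i∈))
        where
        lt : (toℕ (ι i) <ᵇ toℕ (ℓ {n})) ≡ true
        lt = <ᵇ-t (subst₂ _<_ (sym (toℕ-inject₁ i)) (sym (toℕ-fromℕ n)) (toℕ<n i))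
      from m | inj₂ m2 with ∈-map⁻ sh m2
      ... | (p , q) , pq∈ , refl = ⇒edges G' (trans (isEdge-sh G' G P1 p q) (edges⇒ G pq∈))

  edges-add : (H G : Graph n) (a b : Fin n) → toℕ a < toℕ b → adj G a b ≡ false →
              (∀ i j → adj H i j ≡ adj G i j ∨ (((i == a) ∧ (j == b)) ∨ ((i == b) ∧ (j == a)))) →
              edges H ↭ (a , b) ∷ edges G
  edges-add H G a b a<b Gab PH = unique-perm (edges-unique H) (All.tabulate new ∷ edges-unique G) same
    where
    new : ∀ {z} → z ∈ edges G → ¬ (a , b) ≡ z
    new m refl = t≢f (proj₂ (∧⇒ {toℕ a <ᵇ toℕ b} (edges⇒ G m))) Gab
    same : edges H ≈ₛ ((a , b) ∷ edges G)
    same (x , y) = to , from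
      where
      to : (x , y) ∈ edges H → (x , y) ∈ (a , b) ∷ edges G
      to m with ∧⇒ {toℕ x <ᵇ toℕ y} (edges⇒ H m)
      ... | lt , h with ∨⇒ {adj G x y} (trans (sym (PH x y)) h)
      ... | inj₁ g = there (⇒edges G (⇒∧ lt g))
      ... | inj₂ o with ∨⇒ o
      ... | inj₁ c with ∧⇒ c
      ... | p , q with ==⇒ {a = x} {a} p | ==⇒ {a = y} {b} q
      ... | refl | refl = here refl
      to m | lt , h | inj₂ o | inj₂ c with ∧⇒ c
      ... | p , q with ==⇒ {a = x} {b} p | ==⇒ {a = y} {a} q
      ... | refl | refl = ⊥-elim (<-asym a<b (<ᵇ⇒< _ _ (⇒T lt)))
      from : (x , y) ∈ (a , b) ∷ edges G → (x , y) ∈ edges H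
      from (here refl) = ⇒edges H (⇒∧ (<ᵇ-t a<b) (trans (PH a b) (∨ʳ (adj G a b) (∨ˡ _ (⇒∧ (==-refl a) (==-refl b))))))
      from (there m) with ∧⇒ {toℕ x <ᵇ toℕ y} (edges⇒ G m)
      ... | lt , g = ⇒edges H (⇒∧ lt (trans (PH x y) (∨ˡ _ g)))

-- the connected subgraphs of G + ab containing R that use the new edge ab
Fthrough : ∀ {n} → Graph n → (Fin n → Bool) → Fin n → Fin n → ℕ
Fthrough {n} G R a b = sumL (λ v → cnt (λ s → conn v ((a , b) ∷ s) ∧ contains R v) (sublists (edges G))) (subsets n)

add-edge : ∀ {n} (H G : Graph n) (R : Fin n → Bool) (a b : Fin n) → toℕ a < toℕ b → adj G a b ≡ false →
           (∀ i j → adj H i j ≡ adj G i j ∨ (((i == a) ∧ (j == b)) ∨ ((i == b) ∧ (j == a)))) →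
           Fwith H R ≡ Fwith G R + Fthrough G R a b
add-edge {n} H G R a b lt Gab PH =
  trans (sumL-cong (subsets n) (λ V _ → trans (cnt-sublists-↭ (admissible V) (λ s s' e → cong (_∧ contains R V) (conn-≈ V s s' e)) (edges-add H G a b lt Gab PH))
                                               (cnt-sublists-∷ (admissible V) (a , b) (edges G))))
        (sumL-+ (λ V → cnt (admissible V) (sublists (edges G))) _ (subsets n))
  where
  admissible : Vec Bool n → EdgeList n → Bool
  admissible V E = conn V E ∧ contains R V

-- Summing over
-- v ∷ʳ h and over the edges at ℓ, each case is evaluated by the connectivity
-- facts above:  h = false with no edge at ℓ gives Fwith G R (if ℓ ∉ R'), h =
-- false with an edge at ℓ gives nothing, h = true gives the isolated vertex ℓ
-- (if R = ∅), one edge rℓ gives Fwith G (R ∪ {r}), two edges aℓ, bℓ give the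
-- subgraphs of G + ab through ab.

cnt-required-ℓ : ∀ {A : Set} (c : Bool) (q : A → Bool) (t : Bool) xs →
                 cnt (λ s → q s ∧ (t ∧ (not c ∨ false))) xs ≡ (if c then 0 else cnt (λ s → q s ∧ t) xs)
cnt-required-ℓ true q t xs = trans (cnt-cong xs (λ s _ → trans (cong (q s ∧_) (∧-zeroʳ t)) (∧-zeroʳ (q s)))) (cnt-false xs)
cnt-required-ℓ false q t xs = cnt-cong xs (λ s _ → cong (q s ∧_) (∧-identityʳ t))

sumL-if : ∀ {A : Set} (c : Bool) (f : A → ℕ) xs → sumL (λ v → if c then 0 else f v) xs ≡ (if c then 0 else sumL f xs)
sumL-if true f xs = sumL-0 xs
sumL-if false f xs = refl

module DeleteLast {n : ℕ} (G' : Graph (suc n)) (G : Graph n) (R' : Fin (suc n) → Bool) where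
  R : Fin n → Bool
  R = R' ∘ ι

  L : EdgeList n
  L = edges G

  admissible : Vec Bool (suc n) → EdgeList (suc n) → Bool
  admissible V E = conn V E ∧ contains R' V

  split-last : ∀ M → edges G' ↭ M →
               Fwith G' R' ≡ sumL (λ v → cnt (admissible (v ∷ʳ false)) (sublists M) + cnt (admissible (v ∷ʳ true)) (sublists M)) (subsets n)
  split-last M p = trans (sumL-cong (subsets (suc n)) (λ V _ → cnt-sublists-↭ (admissible V) (invariant V) p))
                         (sum-subsets-snoc (λ V → cnt (admissible V) (sublists M)))
    where
    invariant : ∀ V → SetInvariant (admissible V)
    invariant V s s' e = cong (_∧ contains R' V) (conn-≈ V s s' e)

  count-absent : ∀ v → cnt (λ s → admissible (v ∷ʳ false) (map sh s)) (sublists L) ≡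
                       (if R' ℓ then 0 else cnt (λ s → conn v s ∧ contains R v) (sublists L))
  count-absent v = trans (cnt-cong (sublists L) (λ s _ → cong₂ _∧_ (conn-ℓ-absent v s) (contains-snoc R' v false)))
                         (cnt-required-ℓ (R' ℓ) (conn v) (contains R v) (sublists L))

  count-absent-edge : ∀ v c (f : EdgeList n → EdgeList (suc n)) → cnt (λ s → admissible (v ∷ʳ false) ((c , ℓ) ∷ f s)) (sublists L) ≡ 0
  count-absent-edge v c f = trans (cnt-cong (sublists L) (λ s _ → cong (_∧ contains R' (v ∷ʳ false)) (conn-ℓ-absent-edge v c (f s))))
                                  (cnt-false (sublists L))

  count-isolated : ∀ v → cnt (λ s → admissible (v ∷ʳ true) (map sh s)) (sublists L) ≡ b2n (allF v ∧ contains R v)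
  count-isolated v = trans (cnt-cong (sublists L) (λ s _ → trans (cong₂ _∧_ (conn-ℓ-isolated v s) (contains-snoc R' v true))
                                                                  (regroup (allF v) (null s) (contains R v) (not (R' ℓ)))))
                           (cnt-sublists-null (allF v ∧ contains R v) L)
    where
    regroup : ∀ a z c y → (a ∧ z) ∧ (c ∧ (y ∨ true)) ≡ (a ∧ c) ∧ z
    regroup a z c y rewrite ∨-zeroʳ y | ∧-identityʳ c with a | z | c
    ... | true | true | true = refl
    ... | true | true | false = refl
    ... | true | false | true = refl
    ... | true | false | false = refl
    ... | false | _ | _ = refl

  count-pendant : ∀ v c → cnt (λ s → admissible (v ∷ʳ true) ((ι c , ℓ) ∷ map sh s)) (sublists L) ≡
                          cnt (λ s → conn v s ∧ contains (λ j → R j ∨ (j == c)) v) (sublists L)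
  count-pendant v c = cnt-cong (sublists L) (λ s _ → trans (cong₂ _∧_ (conn-ℓ-pendant v c s) (contains-snoc R' v true))
    (trans (regroup (conn v s) (lookup v c) (contains R v) (not (R' ℓ))) (cong (conn v s ∧_) (sym (contains-∪ R c v)))))
    where
    regroup : ∀ a l c y → (a ∧ l) ∧ (c ∧ (y ∨ true)) ≡ a ∧ (c ∧ l)
    regroup a l c y rewrite ∨-zeroʳ y | ∧-identityʳ c with a | l | c
    ... | true | true | true = refl
    ... | true | true | false = refl
    ... | true | false | true = refl
    ... | true | false | false = refl
    ... | false | _ | _ = refl

  count-subdivides : ∀ v a b → cnt (λ s → admissible (v ∷ʳ true) ((ι a , ℓ) ∷ (ι b , ℓ) ∷ map sh s)) (sublists L) ≡
                               cnt (λ s → conn v ((a , b) ∷ s) ∧ contains R v) (sublists L)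
  count-subdivides v a b = cnt-cong (sublists L) (λ s _ → trans (cong₂ _∧_ (conn-ℓ-subdivides v a b s) (contains-snoc R' v true))
    (cong (conn v ((a , b) ∷ s) ∧_) (trans (cong (contains R v ∧_) (∨-zeroʳ (not (R' ℓ)))) (∧-identityʳ (contains R v)))))

  sum-absent : sumL (λ v → if R' ℓ then 0 else cnt (λ s → conn v s ∧ contains R v) (sublists L)) (subsets n) ≡ (if R' ℓ then 0 else Fwith G R)
  sum-absent = sumL-if (R' ℓ) _ (subsets n)

  sum-isolated : sumL (λ v → b2n (allF v ∧ contains R v)) (subsets n) ≡ b2n (isEmpty R)
  sum-isolated = trans (sum-allF (contains R)) (cong b2n (contains-empty R))

  pendant : (r : Fin n) → (∀ i j → adj G' (ι i) (ι j) ≡ adj G i j) → (∀ i → adj G' (ι i) ℓ ≡ (i == r)) →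
            Fwith G' R' ≡ (if R' ℓ then 0 else Fwith G R) + (b2n (isEmpty R) + Fwith G (λ j → R j ∨ (j == r)))
  pendant r P1 P2 = begin
      Fwith G' R'
    ≡⟨ split-last M perm ⟩
      sumL (λ v → cnt (admissible (v ∷ʳ false)) (sublists M) + cnt (admissible (v ∷ʳ true)) (sublists M)) (subsets n)
    ≡⟨ sumL-cong (subsets n) (λ v _ → by-case v) ⟩
      sumL (λ v → absent v + (isolated v + through-r v)) (subsets n)
    ≡⟨ trans (sumL-+ absent _ (subsets n)) (cong (sumL absent (subsets n) +_) (sumL-+ isolated through-r (subsets n))) ⟩
      sumL absent (subsets n) + (sumL isolated (subsets n) + sumL through-r (subsets n))
    ≡⟨ cong₂ _+_ sum-absent (cong (_+ sumL through-r (subsets n)) sum-isolated) ⟩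
      (if R' ℓ then 0 else Fwith G R) + (b2n (isEmpty R) + Fwith G (λ j → R j ∨ (j == r))) ∎
    where
    open ≡-Reasoning
    e : Fin (suc n) × Fin (suc n)
    e = (ι r , ℓ)
    M : EdgeList (suc n)
    M = e ∷ map sh L
    perm : edges G' ↭ M
    perm = edges-snoc G' G (r ∷ []) ([] ∷ []) P1
      (λ i h → here (==⇒ (trans (sym (P2 i)) h)))
      (λ { i (here refl) → trans (P2 i) (==-refl i) })
    absent isolated through-r : Vec Bool n → ℕ
    absent v = if R' ℓ then 0 else cnt (λ s → conn v s ∧ contains R v) (sublists L)
    isolated v = b2n (allF v ∧ contains R v)
    through-r v = cnt (λ s → conn v s ∧ contains (λ j → R j ∨ (j == r)) v) (sublists L)
    split : ∀ V → cnt (admissible V) (sublists M) ≡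
                  cnt (λ s → admissible V (map sh s)) (sublists L) + cnt (λ s → admissible V (e ∷ map sh s)) (sublists L)
    split V = trans (cnt-sublists-∷ (admissible V) e (map sh L))
                    (cong₂ _+_ (cnt-sublists-map (admissible V) sh L) (cnt-sublists-map (λ s → admissible V (e ∷ s)) sh L))
    by-case : ∀ v → cnt (admissible (v ∷ʳ false)) (sublists M) + cnt (admissible (v ∷ʳ true)) (sublists M) ≡
                    absent v + (isolated v + through-r v)
    by-case v = trans (cong₂ _+_ (split (v ∷ʳ false)) (split (v ∷ʳ true)))
      (trans (cong₂ _+_ (cong₂ _+_ (count-absent v) (count-absent-edge v (ι r) (map sh))) (cong₂ _+_ (count-isolated v) (count-pendant v r)))
             (cong (_+ (isolated v + through-r v)) (+-identityʳ (absent v))))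

  subdivide : (a b : Fin n) → ¬ a ≡ b → (∀ i j → adj G' (ι i) (ι j) ≡ adj G i j) →
              (∀ i → adj G' (ι i) ℓ ≡ (i == a) ∨ (i == b)) →
              Fwith G' R' ≡ (if R' ℓ then 0 else Fwith G R) +
                            (b2n (isEmpty R) + (Fwith G (λ j → R j ∨ (j == b)) + (Fwith G (λ j → R j ∨ (j == a)) + Fthrough G R a b)))
  subdivide a b a≢b P1 P2 = begin
      Fwith G' R'
    ≡⟨ split-last M perm ⟩
      sumL (λ v → cnt (admissible (v ∷ʳ false)) (sublists M) + cnt (admissible (v ∷ʳ true)) (sublists M)) (subsets n)
    ≡⟨ sumL-cong (subsets n) (λ v _ → by-case v) ⟩
      sumL (λ v → absent v + (isolated v + (through-b v + (through-a v + through-ab v)))) (subsets n)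
    ≡⟨ sums ⟩
      sumL absent (subsets n) + (sumL isolated (subsets n) + (sumL through-b (subsets n) + (sumL through-a (subsets n) + sumL through-ab (subsets n))))
    ≡⟨ cong₂ _+_ sum-absent (cong (_+ (sumL through-b (subsets n) + (sumL through-a (subsets n) + sumL through-ab (subsets n)))) sum-isolated) ⟩
      (if R' ℓ then 0 else Fwith G R) + (b2n (isEmpty R) + (Fwith G (λ j → R j ∨ (j == b)) + (Fwith G (λ j → R j ∨ (j == a)) + Fthrough G R a b))) ∎
    where
    open ≡-Reasoning
    ea eb : Fin (suc n) × Fin (suc n)
    ea = (ι a , ℓ)
    eb = (ι b , ℓ)
    M : EdgeList (suc n)
    M = ea ∷ eb ∷ map sh L
    perm : edges G' ↭ M
    perm = edges-snoc G' G (a ∷ b ∷ []) ((a≢b ∷ []) ∷ [] ∷ []) P1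
      (λ i h → neighbour i (trans (sym (P2 i)) h))
      (λ { i (here refl) → trans (P2 i) (∨ˡ _ (==-refl i)) ; i (there (here refl)) → trans (P2 i) (∨ʳ (i == a) (==-refl i)) })
      where
      neighbour : ∀ i → (i == a) ∨ (i == b) ≡ true → i ∈ a ∷ b ∷ []
      neighbour i h with ∨⇒ {i == a} h
      ... | inj₁ p = here (==⇒ p)
      ... | inj₂ q = there (here (==⇒ q))
    absent isolated through-a through-b through-ab : Vec Bool n → ℕ
    absent v = if R' ℓ then 0 else cnt (λ s → conn v s ∧ contains R v) (sublists L)
    isolated v = b2n (allF v ∧ contains R v)
    through-b v = cnt (λ s → conn v s ∧ contains (λ j → R j ∨ (j == b)) v) (sublists L)
    through-a v = cnt (λ s → conn v s ∧ contains (λ j → R j ∨ (j == a)) v) (sublists L)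
    through-ab v = cnt (λ s → conn v ((a , b) ∷ s) ∧ contains R v) (sublists L)
    split : ∀ V → cnt (admissible V) (sublists M) ≡
      (cnt (λ s → admissible V (map sh s)) (sublists L) + cnt (λ s → admissible V (eb ∷ map sh s)) (sublists L)) +
      (cnt (λ s → admissible V (ea ∷ map sh s)) (sublists L) + cnt (λ s → admissible V (ea ∷ eb ∷ map sh s)) (sublists L))
    split V = trans (cnt-sublists-∷ (admissible V) ea (eb ∷ map sh L)) (cong₂ _+_
      (trans (cnt-sublists-∷ (admissible V) eb (map sh L))
             (cong₂ _+_ (cnt-sublists-map (admissible V) sh L) (cnt-sublists-map (λ s → admissible V (eb ∷ s)) sh L)))
      (trans (cnt-sublists-∷ (λ s → admissible V (ea ∷ s)) eb (map sh L))
             (cong₂ _+_ (cnt-sublists-map (λ s → admissible V (ea ∷ s)) sh L) (cnt-sublists-map (λ s → admissible V (ea ∷ eb ∷ s)) sh L))))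
    by-case : ∀ v → cnt (admissible (v ∷ʳ false)) (sublists M) + cnt (admissible (v ∷ʳ true)) (sublists M) ≡
                    absent v + (isolated v + (through-b v + (through-a v + through-ab v)))
    by-case v = trans (cong₂ _+_ (split (v ∷ʳ false)) (split (v ∷ʳ true)))
      (trans (cong₂ _+_ (cong₂ _+_ (cong₂ _+_ (count-absent v) (count-absent-edge v (ι b) (map sh)))
                                   (cong₂ _+_ (count-absent-edge v (ι a) (map sh)) (count-absent-edge v (ι a) (λ s → eb ∷ map sh s))))
                        (cong₂ _+_ (cong₂ _+_ (count-isolated v) (count-pendant v b)) (cong₂ _+_ (count-pendant v a) (count-subdivides v a b))))
             (regroup (absent v) (isolated v) (through-b v) (through-a v) (through-ab v)))
      where
      regroup : ∀ p q r s t → ((p + 0) + (0 + 0)) + ((q + r) + (s + t)) ≡ p + (q + (r + (s + t)))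
      regroup = solve-∀
    sums : sumL (λ v → absent v + (isolated v + (through-b v + (through-a v + through-ab v)))) (subsets n) ≡
           sumL absent (subsets n) + (sumL isolated (subsets n) + (sumL through-b (subsets n) + (sumL through-a (subsets n) + sumL through-ab (subsets n))))
    sums = trans (sumL-+ absent _ (subsets n)) (cong (sumL absent (subsets n) +_)
             (trans (sumL-+ isolated _ (subsets n)) (cong (sumL isolated (subsets n) +_)
             (trans (sumL-+ through-b _ (subsets n)) (cong (sumL through-b (subsets n) +_) (sumL-+ through-a through-ab (subsets n)))))))

-- Path m has vertices 0, …, m−1 and edges i ~ i+1; deleting its last
-- vertex leaves a path, the deleted vertex being pendant.

tri : ℕ → ℕ
tri zero = 0
tri (suc g) = tri g + suc g

suc≢ᵇ : ∀ m → (suc m ≡ᵇ m) ≡ false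
suc≢ᵇ zero = refl
suc≢ᵇ (suc m) = suc≢ᵇ m

pathAdj : ∀ {n} → Fin n → Fin n → Bool
pathAdj i j = (suc (toℕ i) ≡ᵇ toℕ j) ∨ (suc (toℕ j) ≡ᵇ toℕ i)

Path : (n : ℕ) → Graph n
Path n = record
  { adj = pathAdj
  ; adj-sym = λ i j → ∨-comm (suc (toℕ i) ≡ᵇ toℕ j) (suc (toℕ j) ≡ᵇ toℕ i)
  ; adj-irrefl = λ i → cong₂ _∨_ (suc≢ᵇ (toℕ i)) (suc≢ᵇ (toℕ i))
  }

ι==fz : ∀ {n} (j : Fin (suc n)) → (ι j == fz) ≡ (j == fz)
ι==fz j rewrite toℕ-inject₁ j = refl

ι==ℓ : ∀ {n} (j : Fin n) → (ι j == ℓ) ≡ false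
ι==ℓ {n} j rewrite toℕ-inject₁ j | toℕ-fromℕ n = ≡ᵇ-f (λ e → <-irrefl e (toℕ<n j))

at-first at-last at-ends : ∀ m → Fin (suc m) → Bool
at-first m j = j == fz
at-last m j = j == fromℕ m
at-ends m j = (j == fz) ∨ (j == fromℕ m)

path-ι : ∀ {n} (i j : Fin n) → adj (Path (suc n)) (ι i) (ι j) ≡ adj (Path n) i j
path-ι i j rewrite toℕ-inject₁ i | toℕ-inject₁ j = refl

path-ℓ : ∀ m (i : Fin (suc m)) → adj (Path (suc (suc m))) (ι i) ℓ ≡ (i == fromℕ m)
path-ℓ m i rewrite toℕ-inject₁ i | toℕ-fromℕ m =
  trans (cong ((toℕ i ≡ᵇ m) ∨_) (≡ᵇ-f (λ e → <-irrefl (sym e) (<-trans (toℕ<n i) (n<1+n _))))) (∨-identityʳ _)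

path-step : ∀ m (R' : Fin (suc (suc m)) → Bool) →
            Fwith (Path (suc (suc m))) R' ≡ (if R' ℓ then 0 else Fwith (Path (suc m)) (R' ∘ ι)) +
              (b2n (isEmpty (R' ∘ ι)) + Fwith (Path (suc m)) (λ j → R' (ι j) ∨ (j == fromℕ m)))
path-step m R' = DeleteLast.pendant (Path (suc (suc m))) (Path (suc m)) R' (fromℕ m) path-ι (path-ℓ m)

record PathValues (m : ℕ) : Set where
  field
    free  : Fwith (Path (suc m)) ∅ ≡ tri (suc m)
    first : Fwith (Path (suc m)) (at-first m) ≡ suc m
    last  : Fwith (Path (suc m)) (at-last m) ≡ suc m
    ends  : Fwith (Path (suc m)) (at-ends m) ≡ 1

path-values : ∀ m → PathValues m
path-values zero = record { free = refl ; first = refl ; last = refl ; ends = refl }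
path-values (suc m) = record { free = free' ; first = first' ; last = last' ; ends = ends' }
  where
  open PathValues (path-values m)
  P : Graph (suc m)
  P = Path (suc m)
  free' : Fwith (Path (suc (suc m))) ∅ ≡ tri (suc (suc m))
  free' = trans (path-step m ∅) (cong₂ _+_ free (cong₂ _+_ (cong b2n (isEmpty-∅ {suc m})) last))
  last' : Fwith (Path (suc (suc m))) (at-last (suc m)) ≡ suc (suc m)
  last' = trans (path-step m (at-last (suc m)))
    (cong₂ _+_ (if-t (==-refl (fromℕ (suc m))))
      (cong₂ _+_ (cong b2n (trans (isEmpty-cong {suc m} ι==ℓ) (isEmpty-∅ {suc m})))
                 (trans (Fwith-cong P (λ j → cong (_∨ (j == fromℕ m)) (ι==ℓ j))) last)))
  first' : Fwith (Path (suc (suc m))) (at-first (suc m)) ≡ suc (suc m)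
  first' = trans (path-step m (at-first (suc m)))
    (trans (cong₂ _+_ (trans (Fwith-cong P ι==fz) first)
      (cong₂ _+_ (cong b2n (isEmpty-cong {suc m} ι==fz))
                 (trans (Fwith-cong P (λ j → cong (_∨ (j == fromℕ m)) (ι==fz j))) ends)))
      (+-comm (suc m) 1))
  ends' : Fwith (Path (suc (suc m))) (at-ends (suc m)) ≡ 1
  ends' = trans (path-step m (at-ends (suc m)))
    (cong₂ _+_ (if-t (∨ʳ (ℓ {suc m} == fz) (==-refl (fromℕ (suc m)))))
      (cong₂ _+_ (cong b2n (isEmpty-cong {suc m} (λ j → cong₂ _∨_ (ι==fz j) (ι==ℓ j))))
                 (trans (Fwith-cong P (λ j → cong (_∨ (j == fromℕ m)) (trans (cong₂ _∨_ (ι==fz j) (ι==ℓ j)) (∨-identityʳ _)))) ends)))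

-- The cycle C_g is the pineapple U^p_{g,g}.  Deleting its last vertex
-- g−1 (of degree two, adjacent to 0 and g−2) leaves the path P on g−1
-- vertices, and C_{g−1} is P plus the edge {0, g−2}.

pineAdjℕ : ℕ → ℕ → ℕ → Bool
pineAdjℕ g x y = not (x ≡ᵇ y) ∧ (pineRaw g x y ∨ pineRaw g y x)

pineRaw-below : ∀ g a b → b < g → pineRaw (suc g) a b ≡ (suc a ≡ᵇ b)
pineRaw-below g a b lt rewrite <ᵇ-t {b} {suc g} (m≤n⇒m≤1+n lt) | ≡ᵇ-f {b} {g} (λ e → <-irrefl e lt)
                             | ≤ᵇ-f {suc g} {b} (λ le → <-irrefl refl (≤-trans lt (≤-trans (n≤1+n g) le))) =
  trans (cong₂ _∨_ (∧-identityʳ _) (cong₂ _∨_ (∧-zeroʳ (a ≡ᵇ 0)) (∧-zeroʳ (a ≡ᵇ 0)))) (∨-identityʳ _)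

consecutive-distinct : ∀ a b → not (a ≡ᵇ b) ∧ ((suc a ≡ᵇ b) ∨ (suc b ≡ᵇ a)) ≡ (suc a ≡ᵇ b) ∨ (suc b ≡ᵇ a)
consecutive-distinct a b with a ≡ᵇ b in eq
... | false = refl
... | true with ≡ᵇ⇒≡ a b (⇒T eq)
... | refl rewrite suc≢ᵇ a = refl

pine-adj-below-last : ∀ g a b → a < g → b < g → pineAdjℕ (suc g) a b ≡ (suc a ≡ᵇ b) ∨ (suc b ≡ᵇ a)
pine-adj-below-last g a b la lb rewrite pineRaw-below g a b lb | pineRaw-below g b a la = consecutive-distinct a b

pine-adj-last : ∀ m a → a < suc m → pineAdjℕ (suc (suc m)) a (suc m) ≡ (a ≡ᵇ 0) ∨ (a ≡ᵇ m)
pine-adj-last m a lt rewrite ≡ᵇ-f {a} {suc m} (λ e → <-irrefl e lt) | ≡ᵇ-t {m} {m} refl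
                       | <ᵇ-t {m} {suc m} (n<1+n m) | ≤ᵇ-f {suc (suc m)} {suc m} (λ le → <-irrefl refl le)
                       | ≡ᵇ-f {suc (suc m)} {a} (λ e → <-asym lt (subst (suc m <_) e (n<1+n (suc m)))) =
  trans (cong (_∨ false) (trans (cong₂ _∨_ (∧-identityʳ (a ≡ᵇ m)) (cong₂ _∨_ (∧-identityʳ (a ≡ᵇ 0)) (∧-zeroʳ (a ≡ᵇ 0))))
                                (cong ((a ≡ᵇ m) ∨_) (∨-identityʳ _))))
        (trans (∨-identityʳ _) (∨-comm (a ≡ᵇ m) (a ≡ᵇ 0)))

pine-adj-cycle : ∀ m a b → a < suc m → b < suc m → 2 ≤ m →
                 pineAdjℕ (suc m) a b ≡ ((suc a ≡ᵇ b) ∨ (suc b ≡ᵇ a)) ∨ (((a ≡ᵇ 0) ∧ (b ≡ᵇ m)) ∨ ((a ≡ᵇ m) ∧ (b ≡ᵇ 0)))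
pine-adj-cycle m a b la lb m≥2 with a ≡ᵇ b in eq
... | true with ≡ᵇ⇒≡ a b (⇒T eq)
... | refl rewrite suc≢ᵇ a = sym (not-both-ends a)
  where
  not-both-ends : ∀ a → ((a ≡ᵇ 0) ∧ (a ≡ᵇ m)) ∨ ((a ≡ᵇ m) ∧ (a ≡ᵇ 0)) ≡ false
  not-both-ends zero rewrite ≡ᵇ-f {0} {m} (λ e → <-irrefl e (<-≤-trans (s≤s z≤n) m≥2)) = refl
  not-both-ends (suc a) rewrite ∧-zeroʳ (suc a ≡ᵇ m) = refl
pine-adj-cycle m a b la lb m≥2 | false = trans (cong₂ _∨_ (raw a b lb) (raw b a la))
  (trans (regroup (suc a ≡ᵇ b) ((a ≡ᵇ 0) ∧ (b ≡ᵇ m)) (suc b ≡ᵇ a) ((b ≡ᵇ 0) ∧ (a ≡ᵇ m)))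
         (cong (λ t → ((suc a ≡ᵇ b) ∨ (suc b ≡ᵇ a)) ∨ (((a ≡ᵇ 0) ∧ (b ≡ᵇ m)) ∨ t)) (∧-comm (b ≡ᵇ 0) (a ≡ᵇ m))))
  where
  raw : ∀ x y → y < suc m → pineRaw (suc m) x y ≡ (suc x ≡ᵇ y) ∨ (((x ≡ᵇ 0) ∧ (y ≡ᵇ m)) ∨ false)
  raw x y ly rewrite <ᵇ-t {y} {suc m} ly | ≤ᵇ-f {suc m} {y} (λ le → <-irrefl refl (≤-trans ly le)) =
    cong₂ _∨_ (∧-identityʳ (suc x ≡ᵇ y)) (cong (((x ≡ᵇ 0) ∧ (y ≡ᵇ m)) ∨_) (∧-zeroʳ (x ≡ᵇ 0)))
  regroup : ∀ s x s' y → (s ∨ (x ∨ false)) ∨ (s' ∨ (y ∨ false)) ≡ (s ∨ s') ∨ (x ∨ y)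
  regroup true x s' y = refl
  regroup false true s' y rewrite ∨-zeroʳ s' = refl
  regroup false false true y = refl
  regroup false false false true = refl
  regroup false false false false = refl

cycle-ι : ∀ m (i j : Fin (suc m)) → adj (Pineapple (suc (suc m)) (suc (suc m))) (ι i) (ι j) ≡ adj (Path (suc m)) i j
cycle-ι m i j = trans (cong₂ (pineAdjℕ (suc (suc m))) (toℕ-inject₁ i) (toℕ-inject₁ j)) (pine-adj-below-last (suc m) (toℕ i) (toℕ j) (toℕ<n i) (toℕ<n j))

cycle-ℓ : ∀ m (i : Fin (suc m)) → adj (Pineapple (suc (suc m)) (suc (suc m))) (ι i) ℓ ≡ (i == fz) ∨ (i == fromℕ m)
cycle-ℓ m i = trans (cong₂ (pineAdjℕ (suc (suc m))) (toℕ-inject₁ i) (toℕ-fromℕ (suc m)))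
  (trans (pine-adj-last m (toℕ i) (toℕ<n i)) (cong (λ t → (toℕ i ≡ᵇ 0) ∨ (toℕ i ≡ᵇ t)) (sym (toℕ-fromℕ m))))

cycle-path+edge : ∀ m → 2 ≤ m → ∀ (i j : Fin (suc m)) → adj (Pineapple (suc m) (suc m)) i j ≡
                  adj (Path (suc m)) i j ∨ (((i == fz) ∧ (j == fromℕ m)) ∨ ((i == fromℕ m) ∧ (j == fz)))
cycle-path+edge m m≥2 i j = trans (pine-adj-cycle m (toℕ i) (toℕ j) (toℕ<n i) (toℕ<n j) m≥2)
  (cong (λ t → pathAdj i j ∨ (((toℕ i ≡ᵇ 0) ∧ (toℕ j ≡ᵇ t)) ∨ ((toℕ i ≡ᵇ t) ∧ (toℕ j ≡ᵇ 0)))) (sym (toℕ-fromℕ m)))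

path-ends-apart : ∀ m → 2 ≤ m → adj (Path (suc m)) fz (fromℕ m) ≡ false
path-ends-apart m m≥2 rewrite toℕ-fromℕ m = cong (_∨ false) (≡ᵇ-f {1} {m} (λ e → <-irrefl e m≥2))

path-ends-< : ∀ m → 2 ≤ m → toℕ (fz {m}) < toℕ (fromℕ m)
path-ends-< m m≥2 rewrite toℕ-fromℕ m = <-≤-trans (s≤s z≤n) m≥2

path-ends-≢ : ∀ m → 2 ≤ m → ¬ (fz {m} ≡ fromℕ m)
path-ends-≢ m m≥2 e = <-irrefl (cong toℕ e) (path-ends-< m m≥2)

-- The values on the cycle of length m+1.  In the induction step the subgraphs
-- through the chord {0, m} of the path cancel between C_{m+2} (subdivide) and
-- C_{m+1} (add-edge).
record CycleValues (m : ℕ) : Set where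
  field
    free  : Fwith (Pineapple (suc m) (suc m)) ∅ ≡ suc m * suc m + 1
    first : Fwith (Pineapple (suc m) (suc m)) (at-first m) ≡ tri (suc m) + 1

cycle-values : ∀ d → CycleValues (2 + d)
cycle-values zero = record { free = refl ; first = refl }
cycle-values (suc d) = record { free = free' ; first = first' }
  where
  m : ℕ
  m = 2 + d
  m≥2 : 2 ≤ m
  m≥2 = s≤s (s≤s z≤n)
  open CycleValues (cycle-values d)
  G' : Graph (suc (suc m))
  G' = Pineapple (suc (suc m)) (suc (suc m))
  P Cyc : Graph (suc m)
  P = Path (suc m)
  Cyc = Pineapple (suc m) (suc m)
  path : PathValues m
  path = path-values m
  delete-last : ∀ R' → Fwith G' R' ≡ (if R' ℓ then 0 else Fwith P (R' ∘ ι)) +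
                 (b2n (isEmpty (R' ∘ ι)) + (Fwith P (λ j → R' (ι j) ∨ (j == fromℕ m)) + (Fwith P (λ j → R' (ι j) ∨ (j == fz)) + Fthrough P (R' ∘ ι) fz (fromℕ m))))
  delete-last R' = DeleteLast.subdivide G' P R' fz (fromℕ m) (path-ends-≢ m m≥2) (cycle-ι m) (cycle-ℓ m)
  close-path : ∀ R → Fwith Cyc R ≡ Fwith P R + Fthrough P R fz (fromℕ m)
  close-path R = add-edge Cyc P R fz (fromℕ m) (path-ends-< m m≥2) (path-ends-apart m m≥2) (cycle-path+edge m m≥2)
  X∅ : ℕ
  X∅ = Fthrough P ∅ fz (fromℕ m)
  free' : Fwith G' ∅ ≡ suc (suc m) * suc (suc m) + 1
  free' = begin
      Fwith G' ∅
    ≡⟨ delete-last ∅ ⟩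
      Fwith P ∅ + (b2n (isEmpty {suc m} ∅) + (Fwith P (at-last m) + (Fwith P (at-first m) + X∅)))
    ≡⟨ cong₂ (λ t u → Fwith P ∅ + (b2n t + u)) (isEmpty-∅ {suc m}) (cong₂ (λ t u → t + (u + X∅)) (PathValues.last path) (PathValues.first path)) ⟩
      Fwith P ∅ + (1 + (suc m + (suc m + X∅)))
    ≡⟨ regroup (Fwith P ∅) X∅ (suc m) ⟩
      (Fwith P ∅ + X∅) + (1 + suc m + suc m)
    ≡⟨ cong (_+ (1 + suc m + suc m)) (trans (sym (close-path ∅)) free) ⟩
      (suc m * suc m + 1) + (1 + suc m + suc m)
    ≡⟨ square-step (suc m) ⟩
      suc (suc m) * suc (suc m) + 1 ∎
    where
    open ≡-Reasoning
    regroup : ∀ p X m → p + (1 + (m + (m + X))) ≡ (p + X) + (1 + m + m)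
    regroup = solve-∀
    square-step : ∀ m → (m * m + 1) + (1 + m + m) ≡ suc m * suc m + 1
    square-step = solve-∀
  R : Fin (suc m) → Bool
  R = at-first (suc m) ∘ ι
  XR : ℕ
  XR = Fthrough P R fz (fromℕ m)
  R≗first : ∀ j → R j ≡ at-first m j
  R≗first = ι==fz
  first' : Fwith G' (at-first (suc m)) ≡ tri (suc (suc m)) + 1
  first' = begin
      Fwith G' (at-first (suc m))
    ≡⟨ delete-last (at-first (suc m)) ⟩
      Fwith P R + (0 + (Fwith P (λ j → R j ∨ (j == fromℕ m)) + (Fwith P (λ j → R j ∨ (j == fz)) + XR)))
    ≡⟨ cong₂ (λ t u → Fwith P R + (0 + (t + (u + XR))))
         (trans (Fwith-cong P (λ j → cong (_∨ (j == fromℕ m)) (R≗first j))) (PathValues.ends path))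
         (trans (Fwith-cong P (λ j → trans (cong (_∨ (j == fz)) (R≗first j)) (∨-idem (j == fz)))) (PathValues.first path)) ⟩
      Fwith P R + (0 + (1 + (suc m + XR)))
    ≡⟨ cong (λ t → t + (0 + (1 + (suc m + XR)))) P-first ⟩
      suc m + (0 + (1 + (suc m + XR)))
    ≡⟨ regroup XR (suc m) ⟩
      (suc m + XR) + suc (suc m)
    ≡⟨ cong (_+ suc (suc m)) (trans (cong (_+ XR) (sym P-first)) (trans (sym (close-path R)) (trans (Fwith-cong Cyc R≗first) first))) ⟩
      (tri (suc m) + 1) + suc (suc m)
    ≡⟨ +-+-comm (tri (suc m)) (suc (suc m)) ⟩
      tri (suc (suc m)) + 1 ∎
    where
    open ≡-Reasoning
    P-first : Fwith P R ≡ suc m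
    P-first = trans (Fwith-cong P R≗first) (PathValues.first path)
    regroup : ∀ X m → m + (0 + (1 + (m + X))) ≡ (m + X) + suc m
    regroup = solve-∀
    +-+-comm : ∀ t s → (t + 1) + s ≡ t + s + 1
    +-+-comm = solve-∀

-- U^p_{n+1,g} minus its last vertex is U^p_{n,g}, the deleted
-- vertex being pendant at 0.  With the Mersenne numbers  mersenne k = 2^k − 1
-- the pendant recurrence, started at the cycle, gives for g = m+1 and k pendants
--   F = g² + 1 + k + mersenne k · (tri g + 1),
--   Fwith {0} = (mersenne k + 1) · (tri g + 1).

mersenne : ℕ → ℕ
mersenne zero = 0
mersenne (suc k) = 2 * mersenne k + 1

2^≡mersenne+1 : ∀ k → 2 ^ k ≡ mersenne k + 1
2^≡mersenne+1 zero = refl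
2^≡mersenne+1 (suc k) rewrite 2^≡mersenne+1 k = double (mersenne k)
  where
  double : ∀ x → 2 * (x + 1) ≡ 2 * x + 1 + 1
  double = solve-∀

pineappleF : ℕ → ℕ → ℕ
pineappleF g k = g * g + 1 + k + mersenne k * (tri g + 1)

pine-adj-pendant : ∀ g n a → a < n → g ≤ n → 1 ≤ g → pineAdjℕ g a n ≡ (a ≡ᵇ 0)
pine-adj-pendant (suc g) n a a<n g<n _
  rewrite ≡ᵇ-f {a} {n} (λ e → <-irrefl e a<n)
        | <ᵇ-f {n} {suc g} (λ lt → <-irrefl refl (<-≤-trans lt g<n))
        | ≡ᵇ-f {n} {g} (λ e → <-irrefl (sym e) g<n)
        | ≤ᵇ-t {suc g} {n} g<n
        | ≡ᵇ-f {suc n} {a} (λ e → <-irrefl refl (≤-trans (n≤1+n (suc n)) (subst (λ t → suc t ≤ n) (sym e) a<n)))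
        | ≡ᵇ-f {n} {0} (λ e → <-irrefl refl (subst (λ t → 1 ≤ t) e (≤-trans (s≤s z≤n) g<n)))
  = only-at-0 (suc a ≡ᵇ n) (a ≡ᵇ 0)
  where
  only-at-0 : ∀ x y → ((x ∧ false) ∨ ((y ∧ false) ∨ (y ∧ true))) ∨ (false ∨ (false ∨ false)) ≡ y
  only-at-0 true true = refl
  only-at-0 true false = refl
  only-at-0 false true = refl
  only-at-0 false false = refl

pineapple-ι : ∀ n g (i j : Fin n) → adj (Pineapple (suc n) g) (ι i) (ι j) ≡ adj (Pineapple n g) i j
pineapple-ι n g i j = cong₂ (pineAdjℕ g) (toℕ-inject₁ i) (toℕ-inject₁ j)

pineapple-ℓ : ∀ g n → g ≤ suc n → 1 ≤ g → ∀ (i : Fin (suc n)) → adj (Pineapple (suc (suc n)) g) (ι i) ℓ ≡ (i == fz)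
pineapple-ℓ g n g≤ 1≤g i = trans (cong₂ (pineAdjℕ g) (toℕ-inject₁ i) (toℕ-fromℕ (suc n))) (pine-adj-pendant g (suc n) (toℕ i) (toℕ<n i) g≤ 1≤g)

record PineappleValues (m k : ℕ) : Set where
  field
    free  : Fwith (Pineapple (suc (k + m)) (suc m)) ∅ ≡ pineappleF (suc m) k
    first : Fwith (Pineapple (suc (k + m)) (suc m)) (at-first (k + m)) ≡ (mersenne k + 1) * (tri (suc m) + 1)

pineapple-values : ∀ d k → PineappleValues (2 + d) k
pineapple-values d zero = record
  { free = trans free (no-pendants (suc m * suc m + 1))
  ; first = trans first (sym (*-identityˡ (tri (suc m) + 1))) }
  where
  m : ℕ
  m = 2 + d
  open CycleValues (cycle-values d)
  no-pendants : ∀ a → a ≡ a + 0 + 0 * (tri (suc m) + 1)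
  no-pendants a = sym (trans (+-identityʳ (a + 0)) (+-identityʳ a))
pineapple-values d (suc k) = record { free = free' ; first = first' }
  where
  m : ℕ
  m = 2 + d
  g : ℕ
  g = suc m
  cyc : ℕ
  cyc = tri g + 1
  open PineappleValues (pineapple-values d k)
  G' : Graph (suc (suc (k + m)))
  G' = Pineapple (suc (suc (k + m))) g
  G : Graph (suc (k + m))
  G = Pineapple (suc (k + m)) g
  add-pendant : ∀ R' → Fwith G' R' ≡ (if R' ℓ then 0 else Fwith G (R' ∘ ι)) + (b2n (isEmpty (R' ∘ ι)) + Fwith G (λ j → R' (ι j) ∨ (j == fz)))
  add-pendant R' = DeleteLast.pendant G' G R' fz (pineapple-ι (suc (k + m)) g)
                     (pineapple-ℓ g (k + m) (s≤s (m≤n+m m k)) (s≤s z≤n))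
  first-twice : ∀ j → (at-first (suc (k + m)) (ι j) ∨ (j == fz)) ≡ at-first (k + m) j
  first-twice j = trans (cong (_∨ (j == fz)) (ι==fz j)) (∨-idem (j == fz))
  first' : Fwith G' (at-first (suc (k + m))) ≡ (mersenne (suc k) + 1) * cyc
  first' = trans (add-pendant (at-first (suc (k + m))))
    (trans (cong₂ (λ a b → a + (0 + b)) (trans (Fwith-cong G ι==fz) first) (trans (Fwith-cong G first-twice) first))
           (doubling (mersenne k) cyc))
    where
    doubling : ∀ q t → (q + 1) * t + (0 + (q + 1) * t) ≡ (2 * q + 1 + 1) * t
    doubling = solve-∀
  free' : Fwith G' ∅ ≡ pineappleF g (suc k)
  free' = trans (add-pendant ∅)
    (trans (cong₂ (λ e a → Fwith G ∅ + (b2n e + a)) (isEmpty-∅ {suc (k + m)}) first)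
    (trans (cong (λ a → a + (1 + (mersenne k + 1) * cyc)) free)
           (step (g * g + 1) k (mersenne k) cyc)))
    where
    step : ∀ A k q t → (A + k + q * t) + (1 + (q + 1) * t) ≡ A + suc k + (2 * q + 1) * t
    step = solve-∀

F-pineapple : ∀ n g → 3 ≤ g → g < n → F (Pineapple n g) ≡ pineappleF g (n ∸ g)
F-pineapple n (suc (suc (suc d))) (s≤s (s≤s (s≤s z≤n))) g<n =
  subst (λ N → F (Pineapple N g) ≡ pineappleF g (n ∸ g)) size
        (trans (F≡Fwith∅ (Pineapple (suc ((n ∸ g) + m)) g)) (PineappleValues.free (pineapple-values d (n ∸ g))))
  where
  m : ℕ
  m = 2 + d
  g : ℕ
  g = suc m
  size : suc ((n ∸ g) + m) ≡ n
  size = trans (sym (+-suc (n ∸ g) m)) (m∸n+n≡m (<⇒≤ g<n))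

-- A permutation s of the vertices (with
-- inverse t) permutes the vertex sets, and sends the edge list of G to a
-- permutation of the edge list of the isomorphic graph H once every image
-- edge (s i , s j) is reoriented with its smaller end first (ŝ).  Connectivity
-- is preserved, so the double sum for F G is a rearrangement of that for F H.

vec-ext : ∀ {n} {V W : Vec Bool n} → (∀ i → lookup V i ≡ lookup W i) → V ≡ W
vec-ext {V = V} {W} h = trans (sym (tabulate∘lookup V)) (trans (tabulate-cong h) (tabulate∘lookup W))

module Relabel {n : ℕ} (s t : Fin n → Fin n) (st : ∀ j → s (t j) ≡ j) (ts : ∀ i → t (s i) ≡ i) where
  s-inj : ∀ {i j} → s i ≡ s j → i ≡ j
  s-inj {i} {j} e = trans (sym (ts i)) (trans (cong t e) (ts j))

  σV : Vec Bool n → Vec Bool n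
  σV V = tabulate (λ j → lookup V (t j))

  lookup-σV : ∀ V i → lookup (σV V) (s i) ≡ lookup V i
  lookup-σV V i = trans (lookup∘tabulate _ (s i)) (cong (lookup V) (ts i))

  lookup-σV' : ∀ V j → lookup (σV V) j ≡ lookup V (t j)
  lookup-σV' V j = lookup∘tabulate _ j

  σV-inj : ∀ {V W} → σV V ≡ σV W → V ≡ W
  σV-inj {V} {W} e = vec-ext (λ i → trans (sym (lookup-σV V i)) (trans (cong (λ X → lookup X (s i)) e) (lookup-σV W i)))

  τV : Vec Bool n → Vec Bool n
  τV V = tabulate (λ j → lookup V (s j))

  σV-τV : ∀ W → σV (τV W) ≡ W
  σV-τV W = vec-ext (λ j → trans (lookup-σV' (τV W) j) (trans (lookup∘tabulate _ (t j)) (cong (lookup W) (st j))))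

  subsets-perm : map σV (subsets n) ↭ subsets n
  subsets-perm = unique-perm (map⁺ σV-inj (subsets-unique n)) (subsets-unique n)
    (λ z → (λ _ → subsets-complete z) , (λ _ → subst (_∈ map σV (subsets n)) (σV-τV z) (∈-map⁺ σV (subsets-complete (τV z)))))

  sum-σV : ∀ (f : Vec Bool n → ℕ) → sumL f (subsets n) ≡ sumL (f ∘ σV) (subsets n)
  sum-σV f = trans (sym (sumL-↭ f subsets-perm)) (sumL-map f σV (subsets n))

  ŝ : Fin n × Fin n → Fin n × Fin n
  ŝ (i , j) = if toℕ (s i) <ᵇ toℕ (s j) then (s i , s j) else (s j , s i)

  ŝ-cases : ∀ e → ŝ e ≡ (s (proj₁ e) , s (proj₂ e)) ⊎ ŝ e ≡ (s (proj₂ e) , s (proj₁ e))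
  ŝ-cases (i , j) with toℕ (s i) <ᵇ toℕ (s j)
  ... | true = inj₁ refl
  ... | false = inj₂ refl

  ŝ-lt : ∀ i j → toℕ (s i) < toℕ (s j) → ŝ (i , j) ≡ (s i , s j)
  ŝ-lt i j lt rewrite <ᵇ-t lt = refl

  ŝ-gt : ∀ i j → toℕ (s j) < toℕ (s i) → ŝ (i , j) ≡ (s j , s i)
  ŝ-gt i j gt with toℕ (s i) <ᵇ toℕ (s j) in eq
  ... | true = ⊥-elim (<-asym gt (<ᵇ⇒< _ _ (⇒T eq)))
  ... | false = refl

  reach-s : ∀ E {a b} → Reach E a b → Reach (map ŝ E) (s a) (s b)
  reach-s E = reach-hom s E (map ŝ E) (λ a b j → reach-edge (map ŝ E) (edge a b j))
    where
    image-joins : ∀ {a b} → (a , b) ∈ E → joins (map ŝ E) (s a) (s b) ≡ true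
    image-joins {a} {b} m with ŝ-cases (a , b)
    ... | inj₁ e = ⇒joins (map ŝ E) (subst (_∈ map ŝ E) e (∈-map⁺ ŝ m))
    ... | inj₂ e = ⇒joins' (map ŝ E) (subst (_∈ map ŝ E) e (∈-map⁺ ŝ m))
    edge : ∀ a b → joins E a b ≡ true → joins (map ŝ E) (s a) (s b) ≡ true
    edge a b j with joins⇒ E j
    ... | inj₁ m = image-joins m
    ... | inj₂ m = trans (joins-sym (map ŝ E) (s a) (s b)) (image-joins m)

  reach-t : ∀ E {a b} → Reach (map ŝ E) a b → Reach E (t a) (t b)
  reach-t E = reach-hom t (map ŝ E) E edge
    where
    preimage-reach : ∀ a b → (a , b) ∈ map ŝ E → Reach E (t a) (t b)
    preimage-reach a b m with ∈-map⁻ ŝ m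
    ... | (x , y) , xy∈ , e with ŝ-cases (x , y)
    ... | inj₁ e' with trans e e'
    ... | refl = subst₂ (Reach E) (sym (ts x)) (sym (ts y)) (reach-edge E (⇒joins E xy∈))
    preimage-reach a b m | (x , y) , xy∈ , e | inj₂ e' with trans e e'
    ... | refl = subst₂ (Reach E) (sym (ts y)) (sym (ts x)) (reach-edge E (⇒joins' E xy∈))
    edge : ∀ a b → joins (map ŝ E) a b ≡ true → Reach E (t a) (t b)
    edge a b j with joins⇒ (map ŝ E) j
    ... | inj₁ m = preimage-reach a b m
    ... | inj₂ m = reach-sym E (preimage-reach b a m)

  relabel⇒ : ∀ V E → Connected (σV V) (map ŝ E) → Connected V E
  relabel⇒ V E (connected (u , Vu) ends reach) = connected (t u , trans (sym (lookup-σV' V u)) Vu) ends' reach'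
    where
    ends' : ∀ e → e ∈ E → lookup V (proj₁ e) ≡ true × lookup V (proj₂ e) ≡ true
    ends' (a , b) m with ŝ-cases (a , b) | ends (ŝ (a , b)) (∈-map⁺ ŝ m)
    ... | inj₁ e | p , q rewrite e = trans (sym (lookup-σV V a)) p , trans (sym (lookup-σV V b)) q
    ... | inj₂ e | p , q rewrite e = trans (sym (lookup-σV V a)) q , trans (sym (lookup-σV V b)) p
    reach' : ∀ u w → lookup V u ≡ true → lookup V w ≡ true → Reach E u w
    reach' u w vu vw = subst₂ (Reach E) (ts u) (ts w) (reach-t E (reach (s u) (s w) (trans (lookup-σV V u) vu) (trans (lookup-σV V w) vw)))

  relabel⇐ : ∀ V E → Connected V E → Connected (σV V) (map ŝ E)
  relabel⇐ V E (connected (u , Vu) ends reach) = connected (s u , trans (lookup-σV V u) Vu) ends' reach'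
    where
    ends' : ∀ e → e ∈ map ŝ E → lookup (σV V) (proj₁ e) ≡ true × lookup (σV V) (proj₂ e) ≡ true
    ends' e m with ∈-map⁻ ŝ m
    ... | (a , b) , ab∈ , refl with ŝ-cases (a , b) | ends (a , b) ab∈
    ... | inj₁ e' | p , q rewrite e' = trans (lookup-σV V a) p , trans (lookup-σV V b) q
    ... | inj₂ e' | p , q rewrite e' = trans (lookup-σV V b) q , trans (lookup-σV V a) p
    reach' : ∀ x y → lookup (σV V) x ≡ true → lookup (σV V) y ≡ true → Reach (map ŝ E) x y
    reach' x y vx vy = subst₂ (Reach (map ŝ E)) (st x) (st y)
      (reach-s E (reach (t x) (t y) (trans (sym (lookup-σV' V x)) vx) (trans (sym (lookup-σV' V y)) vy)))

  conn-σ : ∀ V E → conn (σV V) (map ŝ E) ≡ conn V E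
  conn-σ V E = conn-ext (⇒conn V E ∘ relabel⇒ V E) (relabel⇐ V E ∘ conn⇒ V E)

  module _ (G H : Graph n) (hadj : ∀ i j → adj G i j ≡ adj H (s i) (s j)) where

    ŝ-injective : ∀ x y → toℕ (proj₁ x) < toℕ (proj₂ x) → toℕ (proj₁ y) < toℕ (proj₂ y) → ¬ x ≡ y → ¬ ŝ x ≡ ŝ y
    ŝ-injective (a , b) (c , d) ab cd x≢y e with ŝ-cases (a , b) | ŝ-cases (c , d)
    ... | inj₁ e1 | inj₁ e2 with trans (sym e1) (trans e e2)
    ... | q = x≢y (cong₂ _,_ (s-inj (cong proj₁ q)) (s-inj (cong proj₂ q)))
    ŝ-injective (a , b) (c , d) ab cd x≢y e | inj₁ e1 | inj₂ e2 with trans (sym e1) (trans e e2)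
    ... | q with s-inj (cong proj₁ q) | s-inj (cong proj₂ q)
    ... | refl | refl = <-asym ab cd
    ŝ-injective (a , b) (c , d) ab cd x≢y e | inj₂ e1 | inj₁ e2 with trans (sym e1) (trans e e2)
    ... | q with s-inj (cong proj₁ q) | s-inj (cong proj₂ q)
    ... | refl | refl = <-asym ab cd
    ŝ-injective (a , b) (c , d) ab cd x≢y e | inj₂ e1 | inj₂ e2 with trans (sym e1) (trans e e2)
    ... | q = x≢y (cong₂ _,_ (s-inj (cong proj₂ q)) (s-inj (cong proj₁ q)))

    image-edges-unique : Unique (map ŝ (edges G))
    image-edges-unique = AllPairsₚ.map⁺ (distinct (edges G) (edges-unique G) sorted)
      where
      sorted : All (λ e → toℕ (proj₁ e) < toℕ (proj₂ e)) (edges G)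
      sorted = All.tabulate (λ m → <ᵇ⇒< _ _ (⇒T (proj₁ (∧⇒ (edges⇒ G m)))))
      distinct : ∀ xs → Unique xs → All (λ e → toℕ (proj₁ e) < toℕ (proj₂ e)) xs →
                 AllPairs (λ x y → ¬ ŝ x ≡ ŝ y) xs
      distinct [] _ _ = []
      distinct (x ∷ xs) (px ∷ u) (qx ∷ qs) =
        All.tabulate (λ {y} m → ŝ-injective x y qx (All.lookup qs m) (All.lookup px m)) ∷ distinct xs u qs

    edge-preimage : ∀ a b → (a , b) ∈ edges H → (a , b) ∈ map ŝ (edges G)
    edge-preimage a b m with ∧⇒ {toℕ a <ᵇ toℕ b} (edges⇒ H m)
    ... | l , h = go (<-cmp (toℕ (t a)) (toℕ (t b)))
      where
      lt : toℕ a < toℕ b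
      lt = <ᵇ⇒< _ _ (⇒T l)
      lt' : toℕ (s (t a)) < toℕ (s (t b))
      lt' = subst₂ (λ x y → toℕ x < toℕ y) (sym (st a)) (sym (st b)) lt
      in-G : adj G (t a) (t b) ≡ true
      in-G = trans (hadj (t a) (t b)) (trans (cong₂ (adj H) (st a) (st b)) h)
      go : _ → (a , b) ∈ map ŝ (edges G)
      go (tri< c _ _) = subst (_∈ map ŝ (edges G))
        (trans (ŝ-lt (t a) (t b) lt') (cong₂ _,_ (st a) (st b)))
        (∈-map⁺ ŝ (⇒edges G (⇒∧ (<ᵇ-t c) in-G)))
      go (tri≈ _ c _) = ⊥-elim (<-irrefl (cong toℕ (trans (sym (st a)) (trans (cong s (toℕ-injective c)) (st b)))) lt)
      go (tri> _ _ c) = subst (_∈ map ŝ (edges G))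
        (trans (ŝ-gt (t b) (t a) lt') (cong₂ _,_ (st a) (st b)))
        (∈-map⁺ ŝ (⇒edges G (⇒∧ (<ᵇ-t c) (trans (adj-sym G (t b) (t a)) in-G))))

    edge-image : ∀ x y → (x , y) ∈ edges G → ŝ (x , y) ∈ edges H
    edge-image x y m with ∧⇒ {toℕ x <ᵇ toℕ y} (edges⇒ G m)
    ... | l , g = go (<-cmp (toℕ (s x)) (toℕ (s y)))
      where
      in-H : adj H (s x) (s y) ≡ true
      in-H = trans (sym (hadj x y)) g
      go : _ → ŝ (x , y) ∈ edges H
      go (tri< c _ _) rewrite ŝ-lt x y c = ⇒edges H (⇒∧ (<ᵇ-t c) in-H)
      go (tri≈ _ c _) = ⊥-elim (<-irrefl (cong toℕ (s-inj (toℕ-injective c))) (<ᵇ⇒< _ _ (⇒T l)))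
      go (tri> _ _ c) rewrite ŝ-gt x y c = ⇒edges H (⇒∧ (<ᵇ-t c) (trans (adj-sym H (s y) (s x)) in-H))

    edges-perm : edges H ↭ map ŝ (edges G)
    edges-perm = unique-perm (edges-unique H) image-edges-unique same
      where
      same : edges H ≈ₛ map ŝ (edges G)
      same (a , b) = edge-preimage a b , from
        where
        from : (a , b) ∈ map ŝ (edges G) → (a , b) ∈ edges H
        from m with ∈-map⁻ ŝ m
        ... | (x , y) , xy∈ , e = subst (_∈ edges H) (sym e) (edge-image x y xy∈)

    F-relabel : F H ≡ F G
    F-relabel = begin
        F H
      ≡⟨ F-as-sum H ⟩
        sumL (λ W → cnt (conn W) (sublists (edges H))) (subsets n)
      ≡⟨ sumL-cong (subsets n) (λ W _ → trans (cnt-sublists-↭ (conn W) (λ E E' e → conn-≈ W E E' e) edges-perm)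
                                              (cnt-sublists-map (conn W) ŝ (edges G))) ⟩
        sumL (λ W → cnt (λ E → conn W (map ŝ E)) (sublists (edges G))) (subsets n)
      ≡⟨ sum-σV (λ W → cnt (λ E → conn W (map ŝ E)) (sublists (edges G))) ⟩
        sumL (λ V → cnt (λ E → conn (σV V) (map ŝ E)) (sublists (edges G))) (subsets n)
      ≡⟨ sumL-cong (subsets n) (λ V _ → cnt-cong (sublists (edges G)) (λ E _ → conn-σ V E)) ⟩
        sumL (λ V → cnt (conn V) (sublists (edges G))) (subsets n)
      ≡⟨ sym (F-as-sum G) ⟩
        F G ∎
      where open ≡-Reasoning

F-invariant : ∀ {n} (G H : Graph n) → G ≅ H → F G ≡ F H
F-invariant G H (σ , hadj) = sym (Relabel.F-relabel (σ ⟨$⟩ʳ_) (σ ⟨$⟩ˡ_) (λ j → inverseʳ σ) (λ i → inverseˡ σ) G H hadj)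

-- For a fixed number of vertices, moving one
-- vertex from the pendants into the cycle strictly decreases pineappleF (this
-- uses tri g ≥ 2g, i.e. g ≥ 3), so among pineapples on n vertices the value is
-- largest for g = 3 and smallest for g = n − 1.

tri≥2* : ∀ d → 2 * (3 + d) ≤ tri (3 + d)
tri≥2* zero = s≤s (s≤s (s≤s (s≤s (s≤s (s≤s z≤n)))))
tri≥2* (suc d) = ≤-trans (subst (2 * (3 + suc d) ≤_) (rearrange d) (m≤m+n (2 * (3 + suc d)) (2 + d)))
                         (+-monoˡ-≤ (suc (3 + d)) (tri≥2* d))
  where
  rearrange : ∀ d → 2 * (3 + suc d) + (2 + d) ≡ 2 * (3 + d) + suc (3 + d)
  rearrange = solve-∀

pineappleF-step : ∀ d j → pineappleF (suc (3 + d)) j < pineappleF (3 + d) (suc j)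
pineappleF-step d j with m≤n⇒∃[o]m+o≡n (tri≥2* d)
... | e , tri≡ = subst (suc (pineappleF (suc g) j) ≤_) (sym difference) (m≤m+n (suc (pineappleF (suc g) j)) (e + mersenne j * (g + e)))
  where
  g : ℕ
  g = 3 + d
  -- writing tri g = 2g + e, the difference of the two values is 1 + e + mersenne j · (g + e)
  expand : ∀ g j Q e → g * g + 1 + suc j + (2 * Q + 1) * ((2 * g + e) + 1) ≡
           suc (suc g * suc g + 1 + j + Q * (((2 * g + e) + suc g) + 1)) + (e + Q * (g + e))
  expand = solve-∀
  difference : pineappleF g (suc j) ≡ suc (pineappleF (suc g) j) + (e + mersenne j * (g + e))
  difference = subst (λ t → g * g + 1 + suc j + (2 * mersenne j + 1) * (t + 1) ≡
                            suc (suc g * suc g + 1 + j + mersenne j * ((t + suc g) + 1)) + (e + mersenne j * (g + e)))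
                     tri≡ (expand g j (mersenne j) e)

pineappleF-shift : ∀ x g k → 3 ≤ g → pineappleF (suc x + g) k < pineappleF g (suc x + k)
pineappleF-shift x g k (s≤s (s≤s (s≤s {n = d} _))) = steps x d k
  where
  steps : ∀ x d k → pineappleF (suc x + (3 + d)) k < pineappleF (3 + d) (suc x + k)
  steps zero d k = pineappleF-step d k
  steps (suc x) d k =
    <-trans (subst (λ t → pineappleF t k < pineappleF (3 + suc d) (suc x + k)) (+-suc (suc x) (3 + d)) (steps x (suc d) k))
            (pineappleF-step d (suc x + k))

pineappleF-antitone : ∀ n g h → 3 ≤ g → g ≤ h → h ≤ n →
  pineappleF h (n ∸ h) ≤ pineappleF g (n ∸ g) × (pineappleF h (n ∸ h) ≡ pineappleF g (n ∸ g) → g ≡ h)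
pineappleF-antitone n g h 3≤g g≤h h≤n with m≤n⇒∃[o]m+o≡n g≤h | m≤n⇒∃[o]m+o≡n h≤n
... | e , refl | k , refl rewrite m+n∸m≡n (g + e) k | +-assoc g e k | m+n∸m≡n g (e + k) = compare e
  where
  compare : ∀ e → pineappleF (g + e) k ≤ pineappleF g (e + k) × (pineappleF (g + e) k ≡ pineappleF g (e + k) → g ≡ g + e)
  compare zero = ≤-reflexive (cong (λ t → pineappleF t k) (+-identityʳ g)) , λ _ → sym (+-identityʳ g)
  compare (suc x) = <⇒≤ longer , λ eq → ⊥-elim (<-irrefl eq longer)
    where
    longer : pineappleF (g + suc x) k < pineappleF g (suc x + k)
    longer = subst (λ t → pineappleF t k < pineappleF g (suc x + k)) (+-comm (suc x) g) (pineappleF-shift x g k 3≤g)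

upper-value : ∀ n → 3 ≤ n → 7 * 2 ^ (n ∸ 3) + n ≡ pineappleF 3 (n ∸ 3)
upper-value n 3≤n = subst (λ m → 7 * 2 ^ (n ∸ 3) + m ≡ pineappleF 3 (n ∸ 3)) (m+[n∸m]≡n 3≤n) (value (n ∸ 3))
  where
  value : ∀ K → 7 * 2 ^ K + (3 + K) ≡ pineappleF 3 K
  value K rewrite 2^≡mersenne+1 K = expand K (mersenne K)
    where
    expand : ∀ K Q → 7 * (Q + 1) + (3 + K) ≡ 3 * 3 + 1 + K + Q * 7
    expand = solve-∀

[1+c]C2≡tri : ∀ c → suc c C 2 ≡ tri c
[1+c]C2≡tri zero = refl
[1+c]C2≡tri (suc c) = trans (sym (nCk+nC[k+1]≡[n+1]C[k+1] (suc c) 1))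
                            (trans (cong₂ _+_ (nC1≡n (suc c)) ([1+c]C2≡tri c)) (+-comm (suc c) (tri c)))

lower-value : ∀ n → 4 ≤ n → n ^ 2 + 1 + ((n ∸ 2) C 2) ≡ pineappleF (n ∸ 1) (n ∸ (n ∸ 1))
lower-value _ (s≤s (s≤s (s≤s (s≤s {n = c} z≤n)))) rewrite [1+c]C2≡tri (suc c) | m+n∸n≡m 1 c = expand c (tri (suc c))
  where
  expand : ∀ c t → (4 + c) * ((4 + c) * 1) + 1 + t ≡ (3 + c) * (3 + c) + 1 + 1 + 1 * (t + (2 + c) + (3 + c) + 1)
  expand = solve-∀

F-of-pineapple : ∀ {n g} (G : Graph n) → 3 ≤ g → g < n → G ≅ Pineapple n g → F G ≡ pineappleF g (n ∸ g)
F-of-pineapple {n} {g} G 3≤g g<n iso = trans (F-invariant G (Pineapple n g) iso) (F-pineapple _ _ 3≤g g<n)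

attained-only-by : ∀ {n g h b} (G : Graph n) → 3 ≤ g → g < n → 3 ≤ h → h < n → G ≅ Pineapple n g →
                   (pineappleF g (n ∸ g) ≡ pineappleF h (n ∸ h) → h ≡ g) → b ≡ pineappleF h (n ∸ h) →
                   (F G ≡ b) ⇔ (G ≅ Pineapple n h)
attained-only-by {n} G 3≤g g<n 3≤h h<n iso unique b≡ = mk⇔
  (λ F≡b → subst (λ c → G ≅ Pineapple n c) (sym (unique (trans (sym (F-of-pineapple G 3≤g g<n iso)) (trans F≡b b≡)))) iso)
  (λ iso' → trans (F-of-pineapple G 3≤h h<n iso') (sym b≡))

pred<self : ∀ n → 1 ≤ n → n ∸ 1 < n
pred<self (suc n) _ = n<1+n n

theorem4p5 : (n : ℕ) → 4 ≤ n → (G : Graph n) → IsPineapple G →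
    (n ^ 2 + 1 + ((n ∸ 2) C 2) ≤ F G)
    × (F G ≤ 7 * 2 ^ (n ∸ 3) + n)
    × ((F G ≡ 7 * 2 ^ (n ∸ 3) + n) ⇔ (G ≅ Pineapple n 3))
    × ((F G ≡ n ^ 2 + 1 + ((n ∸ 2) C 2)) ⇔ (G ≅ Pineapple n (n ∸ 1)))
theorem4p5 n 4≤n G (g , 3≤g , g<n , iso) =
    subst₂ _≤_ (sym (lower-value n 4≤n)) (sym FG) (proj₁ lower)
  , subst₂ _≤_ (sym FG) (sym (upper-value n 3≤n)) (proj₁ upper)
  , attained-only-by G 3≤g g<n ≤-refl 4≤n iso (proj₂ upper) (upper-value n 3≤n)
  , attained-only-by G 3≤g g<n 3≤n∸1 n∸1<n iso (λ e → sym (proj₂ lower (sym e))) (lower-value n 4≤n)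
  where
  FG : F G ≡ pineappleF g (n ∸ g)
  FG = F-of-pineapple G 3≤g g<n iso
  3≤n : 3 ≤ n
  3≤n = ≤-trans (n≤1+n 3) 4≤n
  3≤n∸1 : 3 ≤ n ∸ 1
  3≤n∸1 = ∸-monoˡ-≤ 1 4≤n
  n∸1<n : n ∸ 1 < n
  n∸1<n = pred<self n (≤-trans (s≤s z≤n) 4≤n)
  upper : pineappleF g (n ∸ g) ≤ pineappleF 3 (n ∸ 3) × (pineappleF g (n ∸ g) ≡ pineappleF 3 (n ∸ 3) → 3 ≡ g)
  upper = pineappleF-antitone n 3 g ≤-refl 3≤g (<⇒≤ g<n)
  lower : pineappleF (n ∸ 1) (n ∸ (n ∸ 1)) ≤ pineappleF g (n ∸ g) × (pineappleF (n ∸ 1) (n ∸ (n ∸ 1)) ≡ pineappleF g (n ∸ g) → g ≡ n ∸ 1)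
  lower = pineappleF-antitone n g (n ∸ 1) 3≤g (∸-monoˡ-≤ 1 g<n) (<⇒≤ n∸1<n)
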